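{- Let $n\ge1$, $d\ge1$, let $c\in\mathsf{SortedRec}(S_{n,d})$ and let $P=\mathsf{f}_{n,d}(c)$ (which lies in $\mathsf{Sawtooth}_{n+1,d}$). Then \[ \mathsf{height}(c)=\mathsf{area}(P)-(n+d)+\binom{n+d}{2}-\binom d2\quad\text{and}\quad\mathsf{topple}_{CTI}(c)=\mathsf{ctiBounce}(P). \]
   Context: The complete split graph $S_{n,d}$ has vertices $s,v_1,\ldots,v_n$ and $w_1,\ldots,w_d$; any two distinct vertices among $s,v_1,\ldots,v_n$ are adjacent, each $w_j$ is adjacent to each of $s,v_1,\ldots,v_n$, no two $w_j$'s are adjacent; $s$ is the sink, $\deg(v_i)=n+d$, $\deg(w_j)=n+1$. A configuration assigns non-negative integers to non-sink vertices, written $(a_1,\ldots,a_n;b_1,\ldots,b_d)$ with $a_i=c(v_i)$, $b_j=c(w_j)$. A non-sink vertex is unstable if its number of grains is $\ge$ its degree; toppling $v$ removes $\deg(v)$ grains from $v$ (if $v\ne s$) and adds one grain to each non-sink neighbour. A stable configuration $c$ is recurrent iff there is an ordering $s=u_0,\ldots,u_{n+d}$ of all vertices such that from $c$, toppling $u_0,\ldots,u_{i-1}$ in turn makes $u_i$ unstable for each $i\ge1$. $\mathsf{SortedRec}(S_{n,d})$: recurrent configurations with $a_1\ge\cdots\ge a_n$ and $b_1\ge\cdots\ge b_d$. $\mathsf{height}(c)=\sum a_i+\sum b_j$. CTI toppling of $c$: topple the sink; then for $i=1,2,\ldots$: topple simultaneously the set $P_i$ of currently unstable clique vertices $v_j$,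 then topple simultaneously the set $Q_i$ of currently unstable independent vertices; stop after the first $i=t$ at which the configuration is stable. $\mathsf{topple}_{CTI}(c)=(|P_1|,|Q_1|,\ldots,|P_t|,|Q_t|)$. Steps: $\mathsf{s}=(0,-1)$, $\mathsf{nw}=(-1,1)$, $\mathsf{n}=(0,1)$, $\mathsf{e}=(1,0)$, $\mathsf{se}=(1,-1)$. $\mathsf{Sawtooth}_{N,d}$ is the set of pairs of lattice paths (upper, lower) from $(0,0)$ to $(N,d)$, the upper with steps in $\{\mathsf{n},\mathsf{se}\}$, the lower with steps in $\{\mathsf{e},\mathsf{n}\}$, meeting only at the endpoints. $\mathsf{f}_{n,d}(c)=(Upp,Low)$ is constructed as follows: (i) for each $i\in[1,d]$ draw a vertical segment from $(1+b_{d+1-i},i-1)$ to $(1+b_{d+1-i},i)$; (ii) join (by horizontal segments) endpoints of these segments having the same $y$-coordinate, join an endpoint with $y$-coordinate $0$ to the origin, and join an endpoint with $y$-coordinate $d$ to $(n+1,d)$; the result is $Low$. (iii) For each $j\in[1,n]$ draw a diagonal segment from $(j-1,3-j+a_{n+1-j})$ to $(j,2-j+a_{n+1-j})$, and draw a diagonal segment from $(n,d+1)$ to $(n+1,d)$; (iv) join (by vertical segments) endpoints of these segments having the same $x$-coordinate, and join an endpoint with $x$-coordinate $0$ to the origin; the result is $Upp$. $\mathsf{area}(P)$ is the number of unit lattice squares contained in the region enclosed by $P$. The CTI-bounce path of $P$ goes from $(n,d)$ to $(0,0)$ with steps in $\{\mathsf{s},\mathsf{nw}\}$: start at $(n,d)$;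 (i) if the current point is on the upper path go to (ii), otherwise move in direction $\mathsf{nw}$ until meeting the upper path; (ii) if the current point is on the lower path go to (iii), otherwise move in direction $\mathsf{s}$ until meeting the lower path; (iii) if the current point is not $(0,0)$ go to (i). The resulting path consists of $p_1$ $\mathsf{nw}$ steps, then $p_1+q_1$ $\mathsf{s}$ steps, then $p_2$ $\mathsf{nw}$ steps, then $p_2+q_2$ $\mathsf{s}$ steps, $\ldots$, then $p_k$ $\mathsf{nw}$ steps and $p_k+q_k$ $\mathsf{s}$ steps; $\mathsf{ctiBounce}(P)=(p_1,q_1,\ldots,p_k,q_k)$. -}

module Defs where

open import Data.Nat as ℕ using (ℕ; zero; suc; _+_; _∸_; _≤_; _<_)
open import Data.Fin as Fin using (Fin)
open import Data.Integer as ℤ using (ℤ; +_)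
open import Data.Product using (_×_; _,_; proj₁; proj₂; Σ)
open import Data.Sum using (_⊎_)
open import Data.Bool using (Bool; true; false; if_then_else_; _∧_; not)
open import Data.Maybe using (Maybe; just; nothing)
import Data.Maybe as Maybe
open import Data.List using (List; []; _∷_; _++_; map; length; reverse; replicate; filterᵇ; zip; zipWith; allFin)
open import Data.Nat.ListAction using (sum)
open import Data.Bool.ListAction using (all; any)
open import Data.List.Relation.Unary.All using (All)
open import Data.List.Membership.Propositional using (_∈_)
open import Data.List.Relation.Binary.Permutation.Propositional using (_↭_)
open import Data.Unit using (⊤)
open import Relation.Binary.PropositionalEquality using (_≡_)
open import Relation.Nullary using (does)
open import Function using (_∘_)

-- The complete split graph S_{n,d}
-- Non-sink vertices: v i (i : Fin n, clique) and w j (j : Fin d, independent).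
-- The sink s is adjacent to every non-sink vertex and is kept implicit.

data NSV (n d : ℕ) : Set where
  v : Fin n → NSV n d
  w : Fin d → NSV n d

adj : ∀ {n d} → NSV n d → NSV n d → Bool
adj (v i) (v j) = not (does (i Fin.≟ j))
adj (v i) (w j) = true
adj (w i) (v j) = true
adj (w i) (w j) = false

eqV : ∀ {n d} → NSV n d → NSV n d → Bool
eqV (v i) (v j) = does (i Fin.≟ j)
eqV (v i) (w j) = false
eqV (w i) (v j) = false
eqV (w i) (w j) = does (i Fin.≟ j)

elemV : ∀ {n d} → NSV n d → List (NSV n d) → Bool
elemV u xs = any (eqV u) xs

isClique : ∀ {n d} → NSV n d → Bool
isClique (v _) = true
isClique (w _) = false

isIndep : ∀ {n d} → NSV n d → Bool
isIndep u = not (isClique u)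

deg : ∀ {n d} → NSV n d → ℕ
deg {n} {d} (v _) = n + d
deg {n} {d} (w _) = n + 1

allNS : (n d : ℕ) → List (NSV n d)
allNS n d = map v (allFin n) ++ map w (allFin d)

Cfg : ℕ → ℕ → Set
Cfg n d = NSV n d → ℕ

Stable : ∀ {n d} → Cfg n d → Set
Stable c = ∀ u → c u < deg u

Unstable : ∀ {n d} → Cfg n d → NSV n d → Set
Unstable c u = deg u ≤ c u

unstableᵇ : ∀ {n d} → Cfg n d → NSV n d → Bool
unstableᵇ c u = deg u ℕ.≤ᵇ c u

stableᵇ : ∀ {n d} → Cfg n d → Bool
stableᵇ {n} {d} c = all (λ u → c u ℕ.<ᵇ deg u) (allNS n d)

toppleSink : ∀ {n d} → Cfg n d → Cfg n d
toppleSink c u = suc (c u)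

-- simultaneous toppling of a set S (a duplicate-free list) of non-sink
-- vertices: each toppled vertex loses deg grains, each non-sink vertex
-- receives one grain from each toppled neighbour.
-- (Only applied to sets of unstable vertices, so ∸ is exact.)
toppleSet : ∀ {n d} → Cfg n d → List (NSV n d) → Cfg n d
toppleSet c S u =
  (c u + length (filterᵇ (λ x → adj x u) S)) ∸ (if elemV u S then deg u else 0)

ValidSeq : ∀ {n d} → Cfg n d → List (NSV n d) → Set
ValidSeq c [] = ⊤
ValidSeq c (u ∷ us) = Unstable c u × ValidSeq (toppleSet c (u ∷ [])) us

Recurrent : ∀ {n d} → Cfg n d → Set
Recurrent {n} {d} c =
  Stable c × Σ (List (NSV n d)) (λ ord → (ord ↭ allNS n d) × ValidSeq (toppleSink c) ord)

Sorted : ∀ {n d} → Cfg n d → Set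
Sorted {n} {d} c =
  (∀ (i j : Fin n) → i Fin.≤ j → c (v j) ≤ c (v i)) ×
  (∀ (i j : Fin d) → i Fin.≤ j → c (w j) ≤ c (w i))

SortedRec : ∀ {n d} → Cfg n d → Set
SortedRec c = Recurrent c × Sorted c

height : ∀ {n d} → Cfg n d → ℕ
height {n} {d} c = sum (map c (allNS n d))

ctiLoop : ∀ {n d} → ℕ → Cfg n d → Maybe (List (ℕ × ℕ))
ctiLoop zero c = nothing
ctiLoop {n} {d} (suc k) c =
  let P  = filterᵇ (λ u → isClique u ∧ unstableᵇ c u) (allNS n d)
      c₁ = toppleSet c P
      Q  = filterᵇ (λ u → isIndep u ∧ unstableᵇ c₁ u) (allNS n d)
      c₂ = toppleSet c₁ Q
      pq = (length P , length Q)
  in if stableᵇ c₂ then just (pq ∷ []) else Maybe.map (pq ∷_) (ctiLoop k c₂)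

-- ToppleCTI c T : the CTI toppling of c terminates and
-- topple_CTI(c) = T = ((|P_1|,|Q_1|), ..., (|P_t|,|Q_t|))
ToppleCTI : ∀ {n d} → Cfg n d → List (ℕ × ℕ) → Set
ToppleCTI c T = Σ ℕ (λ fuel → ctiLoop fuel (toppleSink c) ≡ just T)

data Step : Set where
  stS stNW stN stE stSE : Step

Point : Set
Point = ℤ × ℤ

vec : Step → Point
vec stS  = (+ 0 , ℤ.-1ℤ)
vec stNW = (ℤ.-1ℤ , + 1)
vec stN  = (+ 0 , + 1)
vec stE  = (+ 1 , + 0)
vec stSE = (+ 1 , ℤ.-1ℤ)

_⊕_ : Point → Point → Point
(a , b) ⊕ (c , d) = (a ℤ.+ c , b ℤ.+ d)

origin : Point
origin = (+ 0 , + 0)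

points : Point → List Step → List Point
points p [] = p ∷ []
points p (s ∷ ss) = p ∷ points (p ⊕ vec s) ss

endPt : Point → List Step → Point
endPt p [] = p
endPt p (s ∷ ss) = endPt (p ⊕ vec s) ss

-- a pair (upper , lower) of paths
PathPair : Set
PathPair = List Step × List Step

Sawtooth : ℕ → ℕ → PathPair → Set
Sawtooth N d (U , L) =
  All (λ s → s ≡ stN ⊎ s ≡ stSE) U ×
  All (λ s → s ≡ stE ⊎ s ≡ stN) L ×
  endPt origin U ≡ (+ N , + d) ×
  endPt origin L ≡ (+ N , + d) ×
  (∀ p → p ∈ points origin U → p ∈ points origin L → p ≡ origin ⊎ p ≡ (+ N , + d))

isSE : Step → Bool
isSE stSE = true
isSE _    = false

isE : Step → Bool
isE stE = true
isE _   = false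

stepsWithStart : List Step → List (Point × Step)
stepsWithStart ss = zip (points origin ss) ss

seStartHeights : List Step → List ℤ
seStartHeights U = map (proj₂ ∘ proj₁) (filterᵇ (isSE ∘ proj₂) (stepsWithStart U))

eHeights : List Step → List ℤ
eHeights L = map (proj₂ ∘ proj₁) (filterᵇ (isE ∘ proj₂) (stepsWithStart L))

-- In column x the upper path has
-- a se step from (x,h) to (x+1,h-1) and the lower path an e step at height ℓ;
-- the unit squares [x,x+1]×[y,y+1] inside the region are those with
-- ℓ ≤ y and y+1 ≤ h-1, i.e. there are max(0, h-1-ℓ) of them.
area : PathPair → ℕ
area (U , L) =
  sum (zipWith (λ h ℓ → ℤ.∣ (h ℤ.- ℤ.1ℤ ℤ.- ℓ) ℤ.⊔ + 0 ∣) (seStartHeights U) (eHeights L))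

-- Upp, from r = (a_n, a_{n-1}, ..., a_1):
-- vertical from origin to (0, 2 + a_n), diagonal to (1, 1 + a_n); in column
-- j-1 (j ≥ 2) vertical by a_{n+1-j} - a_{n+2-j} up-steps, diagonal, ...,
-- finally vertical from (n, 2-n+a_1) to (n, d+1) and diagonal to (n+1, d).
uppGo : ℕ → ℕ → ℕ → List ℕ → List Step
uppGo n d prev [] = replicate ((d + n) ∸ (1 + prev)) stN ++ stSE ∷ []
uppGo n d prev (r ∷ rs) = replicate (r ∸ prev) stN ++ stSE ∷ uppGo n d r rs

uppSteps : ℕ → ℕ → List ℕ → List Step
uppSteps n d [] = replicate (d + 1) stN ++ stSE ∷ []
uppSteps n d (r ∷ rs) = replicate (2 + r) stN ++ stSE ∷ uppGo n d r rs

-- Low, from s = (b_d, b_{d-1}, ..., b_1): vertical unit segments at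
-- x = 1 + b_{d+1-i} from y = i-1 to y = i, joined horizontally, the first
-- joined to the origin and the last to (n+1, d).
lowGo : ℕ → ℕ → List ℕ → List Step
lowGo n prev [] = replicate (n ∸ prev) stE
lowGo n prev (s ∷ ss) = replicate (s ∸ prev) stE ++ stN ∷ lowGo n s ss

lowSteps : ℕ → List ℕ → List Step
lowSteps n [] = replicate (n + 1) stE
lowSteps n (s ∷ ss) = replicate (1 + s) stE ++ stN ∷ lowGo n s ss

f : ∀ {n d} → Cfg n d → PathPair
f {n} {d} c =
  ( uppSteps n d (reverse (map (c ∘ v) (allFin n)))
  , lowSteps n (reverse (map (c ∘ w) (allFin d))) )

elemP : Point → List Point → Bool
elemP p xs = any (λ q → does (≡-dec ℤ._≟_ ℤ._≟_ p q)) xs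
  where open import Data.Product.Properties using (≡-dec)

data Mode : Set where
  goNW goS : Mode

-- bounceLoop fuel Upts Lpts mode p k m : current point p, k = number of nw
-- steps in the current round, m = number of s steps in the current round.
bounceLoop : ℕ → List Point → List Point → Mode → Point → ℕ → ℕ → Maybe (List (ℕ × ℕ))
bounceLoop zero Up Lp md p k m = nothing
bounceLoop (suc fuel) Up Lp goNW p k m =
  if elemP p Up then bounceLoop fuel Up Lp goS p k 0
  else bounceLoop fuel Up Lp goNW (p ⊕ vec stNW) (suc k) 0
bounceLoop (suc fuel) Up Lp goS p k m =
  if elemP p Lp
  then (if does (≡-dec ℤ._≟_ ℤ._≟_ p origin)
        then just ((k , m) ∷ [])
        else Maybe.map ((k , m) ∷_) (bounceLoop fuel Up Lp goNW p 0 0))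
  else bounceLoop fuel Up Lp goS (p ⊕ vec stS) k (suc m)
  where open import Data.Product.Properties using (≡-dec)

-- CtiBounce n P T : the CTI-bounce path of P (started at (n,d)) terminates
-- and consists of p_1 nw steps, p_1+q_1 s steps, ..., p_k nw steps,
-- p_k+q_k s steps, where T = ((p_1,q_1), ..., (p_k,q_k)); i.e. ctiBounce(P) = T.
CtiBounce : ℕ → ℕ → PathPair → List (ℕ × ℕ) → Set
CtiBounce n d (U , L) T =
  Σ ℕ (λ fuel →
    bounceLoop fuel (points origin U) (points origin L) goNW (+ n , + d) 0 0
      ≡ just (map (λ pq → (proj₁ pq , proj₁ pq + proj₂ pq)) T))

module Submission where

-- Let a₀ ≥ … ≥ a_{n-1} and b₀ ≥ … ≥ b_{d-1} be the heights on the clique and on the independent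
-- vertices. Once the sink, P clique and Q independent vertices have toppled, the unstable clique
-- vertices are exactly the first P′ = #{k | n + d ≤ a_k + 1 + P + Q} ones and, after those have
-- toppled, the unstable independent vertices are the first Q′ = #{j | n ≤ b_j + P′}. So CTI
-- toppling runs through the rounds (P , Q) ↦ (P′ , Q′) from (0 , 0), and recurrence, read along
-- the ordering of its witness, forces P′ > P until every clique vertex has toppled.
-- Under f, column x of the upper path starts on the antidiagonal 2 + a_{n-1-x} and the lower path
-- has height #{j | b_j < x} = d ∸ Q′ in column x = n ∸ P′, so the bounce path from (n ∸ P , d ∸ Q)
-- goes north-west to column n ∸ P′ and south to (n ∸ P′ , d ∸ Q′): it records the same rounds.
-- Summing the column areas 1 + a_{n-1-x} − x − #{j | b_j < x} and double counting the last term
-- gives the height formula.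

open import Defs
open import Data.Bool using (Bool; true; false; if_then_else_; not; _∧_; _∨_; T)
open import Data.Bool.ListAction using (any; all)
open import Data.Bool.Properties using (T-≡; ∧-zeroʳ; ∧-identityʳ; ∨-identityʳ)
open import Data.Empty using (⊥; ⊥-elim)
open import Data.Fin as Fin using (Fin; toℕ; fromℕ<)
open import Data.Fin.Properties using (toℕ<n; toℕ-fromℕ<; toℕ-injective)
import Data.Integer as ℤ
import Data.Integer.Properties as ℤ
open import Data.List using (List; []; _∷_; _++_; [_]; map; length; reverse; replicate; filter; filterᵇ; zip; zipWith; allFin; tabulate; applyUpTo)
open import Data.List.Membership.Propositional using (_∈_; _∉_)
open import Data.List.Membership.Propositional.Properties using (∈-map⁻; ∈-map⁺; ∈-++⁺ˡ; ∈-allFin)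
open import Data.List.Properties using (++-identityʳ; ++-assoc; length-++; length-map; length-reverse; length-tabulate; map-++; map-∘; map-tabulate; unfold-reverse; filter-++; filter-all; filter-accept; filter-reject; applyUpTo-∷ʳ)
open import Data.List.Relation.Binary.Permutation.Propositional using (↭-sym; ↭⇒↭ₛ)
open import Data.List.Relation.Binary.Permutation.Propositional.Properties using (∈-resp-↭; ↭-reverse; All-resp-↭)
import Data.List.Relation.Binary.Permutation.Setoid.Properties as Perm
open import Data.List.Relation.Unary.All as All using (All; []; _∷_)
open import Data.List.Relation.Unary.All.Properties using (++⁺; ++⁻ˡ; replicate⁺; map⁺; tabulate⁺)
open import Data.List.Relation.Unary.AllPairs using ([]; _∷_)
open import Data.List.Relation.Unary.Any using (here; there)
open import Data.List.Relation.Unary.Unique.Propositional using (Unique)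
import Data.List.Relation.Unary.Unique.Propositional.Properties as Unique
open import Data.Maybe using (Maybe; just)
import Data.Maybe as Maybe
open import Data.Nat using (ℕ; zero; suc; _+_; _∸_; _*_; _≤_; _<_; _≤ᵇ_; _<ᵇ_; z≤n; s≤s; _≤?_; _<?_; _≟_)
open import Data.Nat.Combinatorics using (_C_; nC1≡n; nCk+nC[k+1]≡[n+1]C[k+1])
open import Data.Nat.ListAction using (sum)
open import Data.Nat.ListAction.Properties using (sum-++; sum-↭)
open import Data.Nat.Properties
open import Data.Nat.Tactic.RingSolver using (solve-∀)
open import Data.Product using (_×_; Σ; _,_; proj₁; proj₂; ∃-syntax; ∃₂)
open import Data.Product.Properties using (≡-dec)
open import Data.Sum using (_⊎_; inj₁; inj₂)
open import Function using (_∘_; id; Equivalence)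
open import Relation.Binary.PropositionalEquality hiding ([_])
open import Relation.Nullary using (does; ¬_; ¬?; yes; no)
open import Relation.Nullary.Decidable using (T?; dec-true; dec-false)
open import Algebra.Properties.CommutativeSemigroup +-commutativeSemigroup using (x∙yz≈y∙xz; interchange)

≤⇒≤ᵇ≡true : ∀ {m n} → m ≤ n → (m ≤ᵇ n) ≡ true
≤⇒≤ᵇ≡true = dec-true (_ ≤? _)

>⇒≤ᵇ≡false : ∀ {m n} → n < m → (m ≤ᵇ n) ≡ false
>⇒≤ᵇ≡false n<m = dec-false (_ ≤? _) (<⇒≱ n<m)

≤ᵇ≡true⇒≤ : ∀ {m n} → (m ≤ᵇ n) ≡ true → m ≤ n
≤ᵇ≡true⇒≤ {m} {n} e = ≤ᵇ⇒≤ m n (Equivalence.from T-≡ e)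

≤ᵇ≡false⇒> : ∀ {m n} → (m ≤ᵇ n) ≡ false → n < m
≤ᵇ≡false⇒> {m} {n} e = ≰⇒> (λ m≤n → subst T e (≤⇒≤ᵇ m≤n))

<⇒<ᵇ≡true : ∀ {m n} → m < n → (m <ᵇ n) ≡ true
<⇒<ᵇ≡true = ≤⇒≤ᵇ≡true

≥⇒<ᵇ≡false : ∀ {m n} → n ≤ m → (m <ᵇ n) ≡ false
≥⇒<ᵇ≡false = >⇒≤ᵇ≡false ∘ s≤s

<ᵇ≡true⇒< : ∀ {m n} → (m <ᵇ n) ≡ true → m < n
<ᵇ≡true⇒< = ≤ᵇ≡true⇒≤

<ᵇ≡false⇒≥ : ∀ {m n} → (m <ᵇ n) ≡ false → n ≤ m
<ᵇ≡false⇒≥ = ≤-pred ∘ ≤ᵇ≡false⇒>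

∸-telescope : ∀ {s t m} → s ≤ t → t ≤ m → (t ∸ s) + (m ∸ t) ≡ m ∸ s
∸-telescope {s} {t} {m} s≤t t≤m = begin
  (t ∸ s) + (m ∸ t)   ≡⟨ +-comm (t ∸ s) (m ∸ t) ⟩
  (m ∸ t) + (t ∸ s)   ≡⟨ +-∸-assoc (m ∸ t) s≤t ⟨
  (m ∸ t) + t ∸ s     ≡⟨ cong (_∸ s) (m∸n+n≡m t≤m) ⟩
  m ∸ s               ∎
  where open ≡-Reasoning

∸-<-flip : ∀ {m a b} → m ∸ a < b → b ≤ m → m ∸ b < a
∸-<-flip {m} {a} {b} m∸a<b b≤m =
  ≰⇒> (λ a≤m∸b → <⇒≱ m∸a<b (m+n≤o⇒m≤o∸n b (subst (_≤ m) (+-comm a b) (m≤o∸n⇒m+n≤o a b≤m a≤m∸b))))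

[a+m]+[b∸a]≡b+m : ∀ {a b} m → a ≤ b → a + m + (b ∸ a) ≡ b + m
[a+m]+[b∸a]≡b+m {a} {b} m a≤b = begin
  a + m + (b ∸ a)   ≡⟨ +-assoc a m (b ∸ a) ⟩
  a + (m + (b ∸ a)) ≡⟨ cong (a +_) (+-comm m (b ∸ a)) ⟩
  a + ((b ∸ a) + m) ≡⟨ +-assoc a (b ∸ a) m ⟨
  a + (b ∸ a) + m   ≡⟨ cong (_+ m) (m+[n∸m]≡n a≤b) ⟩
  b + m             ∎
  where open ≡-Reasoning

[m+a]+[b∸a]≡m+b : ∀ {a b} m → a ≤ b → m + a + (b ∸ a) ≡ m + b
[m+a]+[b∸a]≡m+b {a} m a≤b = trans (+-assoc m a _) (cong (m +_) (m+[n∸m]≡n a≤b))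

countᵇ : ∀ {A : Set} → (A → Bool) → List A → ℕ
countᵇ p [] = 0
countᵇ p (x ∷ xs) = if p x then suc (countᵇ p xs) else countᵇ p xs

length-filterᵇ : ∀ {A : Set} (p : A → Bool) xs → length (filterᵇ p xs) ≡ countᵇ p xs
length-filterᵇ p [] = refl
length-filterᵇ p (x ∷ xs) with p x
... | true = cong suc (length-filterᵇ p xs)
... | false = length-filterᵇ p xs

countᵇ-++ : ∀ {A : Set} (p : A → Bool) xs ys → countᵇ p (xs ++ ys) ≡ countᵇ p xs + countᵇ p ys
countᵇ-++ p [] ys = refl
countᵇ-++ p (x ∷ xs) ys with p x
... | true = cong suc (countᵇ-++ p xs ys)
... | false = countᵇ-++ p xs ys

countᵇ-reverse : ∀ {A : Set} (p : A → Bool) xs → countᵇ p (reverse xs) ≡ countᵇ p xs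
countᵇ-reverse p [] = refl
countᵇ-reverse p (x ∷ xs)
  rewrite unfold-reverse x xs | countᵇ-++ p (reverse xs) [ x ] | countᵇ-reverse p xs with p x
... | true = +-comm (countᵇ p xs) 1
... | false = +-identityʳ (countᵇ p xs)

countᵇ+countᵇ-not : ∀ {A : Set} (p : A → Bool) xs → countᵇ p xs + countᵇ (not ∘ p) xs ≡ length xs
countᵇ+countᵇ-not p [] = refl
countᵇ+countᵇ-not p (x ∷ xs) with p x
... | true = cong suc (countᵇ+countᵇ-not p xs)
... | false = trans (+-suc (countᵇ p xs) _) (cong suc (countᵇ+countᵇ-not p xs))

countᵇ-cong : ∀ {A : Set} {p q : A → Bool} xs → (∀ x → p x ≡ q x) → countᵇ p xs ≡ countᵇ q xs
countᵇ-cong [] e = refl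
countᵇ-cong {q = q} (x ∷ xs) e rewrite e x with q x
... | true = cong suc (countᵇ-cong xs e)
... | false = countᵇ-cong xs e

countᵇ-mono : ∀ {A : Set} {p q : A → Bool} xs → (∀ x → p x ≡ true → q x ≡ true) → countᵇ p xs ≤ countᵇ q xs
countᵇ-mono [] _ = z≤n
countᵇ-mono {p = p} {q} (x ∷ xs) p⇒q with p x in px | q x in qx
... | true | true = s≤s (countᵇ-mono xs p⇒q)
... | true | false with () ← trans (sym (p⇒q x px)) qx
... | false | true = m≤n⇒m≤1+n (countᵇ-mono xs p⇒q)
... | false | false = countᵇ-mono xs p⇒q

countᵇ≤length : ∀ {A : Set} (p : A → Bool) xs → countᵇ p xs ≤ length xs
countᵇ≤length p [] = z≤n
countᵇ≤length p (x ∷ xs) with p x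
... | true = s≤s (countᵇ≤length p xs)
... | false = m≤n⇒m≤1+n (countᵇ≤length p xs)

countᵇ-none : ∀ {A : Set} {p : A → Bool} xs → (∀ x → p x ≡ false) → countᵇ p xs ≡ 0
countᵇ-none [] _ = refl
countᵇ-none (x ∷ xs) none rewrite none x = countᵇ-none xs none

countᵇ-all : ∀ {A : Set} {p : A → Bool} xs → (∀ x → p x ≡ true) → countᵇ p xs ≡ length xs
countᵇ-all [] _ = refl
countᵇ-all (x ∷ xs) all rewrite all x = cong suc (countᵇ-all xs all)

countᵇ-filterᵇ : ∀ {A : Set} (p q : A → Bool) xs → countᵇ p (filterᵇ q xs) ≡ countᵇ (λ x → q x ∧ p x) xs
countᵇ-filterᵇ p q [] = refl
countᵇ-filterᵇ p q (x ∷ xs) with q x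
... | false = countᵇ-filterᵇ p q xs
... | true with p x
...   | true = cong suc (countᵇ-filterᵇ p q xs)
...   | false = countᵇ-filterᵇ p q xs

countᵇ-map : ∀ {A B : Set} (p : B → Bool) (f : A → B) xs → countᵇ p (map f xs) ≡ countᵇ (p ∘ f) xs
countᵇ-map p f [] = refl
countᵇ-map p f (x ∷ xs) with p (f x)
... | true = cong suc (countᵇ-map p f xs)
... | false = countᵇ-map p f xs

applyUpTo-cong : ∀ {A : Set} {f g : ℕ → A} m → (∀ {i} → i < m → f i ≡ g i) → applyUpTo f m ≡ applyUpTo g m
applyUpTo-cong zero _ = refl
applyUpTo-cong (suc m) f≗g = cong₂ _∷_ (f≗g (s≤s z≤n)) (applyUpTo-cong m (f≗g ∘ s≤s))

applyUpTo-++ : ∀ {A : Set} (f : ℕ → A) k m → applyUpTo f (k + m) ≡ applyUpTo f k ++ applyUpTo (λ i → f (k + i)) m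
applyUpTo-++ f zero m = refl
applyUpTo-++ f (suc k) m = cong (f 0 ∷_) (applyUpTo-++ (f ∘ suc) k m)

-- Indices past the end give 0; every lemma below carries a bound.
nth : List ℕ → ℕ → ℕ
nth [] _ = 0
nth (x ∷ xs) zero = x
nth (x ∷ xs) (suc k) = nth xs k

nth-++ˡ : ∀ xs ys {i} → i < length xs → nth (xs ++ ys) i ≡ nth xs i
nth-++ˡ (x ∷ xs) ys {zero} _ = refl
nth-++ˡ (x ∷ xs) ys {suc i} (s≤s i<) = nth-++ˡ xs ys i<

nth-++ʳ : ∀ xs ys → nth (xs ++ ys) (length xs) ≡ nth ys 0
nth-++ʳ [] ys = refl
nth-++ʳ (x ∷ xs) ys = nth-++ʳ xs ys

nth-reverse : ∀ xs {i} → i < length xs → nth (reverse xs) i ≡ nth xs (length xs ∸ suc i)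
nth-reverse (x ∷ xs) {i} (s≤s i≤) rewrite unfold-reverse x xs with m≤n⇒m<n∨m≡n i≤
... | inj₁ i<l = begin
  nth (reverse xs ++ [ x ]) i   ≡⟨ nth-++ˡ (reverse xs) [ x ] (subst (i <_) (sym (length-reverse xs)) i<l) ⟩
  nth (reverse xs) i            ≡⟨ nth-reverse xs i<l ⟩
  nth xs (length xs ∸ suc i)    ≡⟨ cong (nth (x ∷ xs)) (sym (+-∸-assoc 1 i<l)) ⟩
  nth (x ∷ xs) (length xs ∸ i)  ∎
  where open ≡-Reasoning
... | inj₂ refl = begin
  nth (reverse xs ++ [ x ]) (length xs) ≡⟨ cong (nth (reverse xs ++ [ x ])) (sym (length-reverse xs)) ⟩
  nth (reverse xs ++ [ x ]) (length (reverse xs)) ≡⟨ nth-++ʳ (reverse xs) [ x ] ⟩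
  x ≡⟨ cong (nth (x ∷ xs)) (sym (n∸n≡0 (length xs))) ⟩
  nth (x ∷ xs) (length xs ∸ length xs) ∎
  where open ≡-Reasoning

nth-tabulate : ∀ {m} (f : Fin m → ℕ) i → nth (tabulate f) (toℕ i) ≡ f i
nth-tabulate f Fin.zero = refl
nth-tabulate f (Fin.suc i) = nth-tabulate (f ∘ Fin.suc) i

nth-map-allFin : ∀ {m} (f : Fin m → ℕ) i → nth (map f (allFin m)) (toℕ i) ≡ f i
nth-map-allFin f i = trans (cong (λ xs → nth xs (toℕ i)) (map-tabulate id f)) (nth-tabulate f i)

length-map-allFin : ∀ {m} (f : Fin m → ℕ) → length (map f (allFin m)) ≡ m
length-map-allFin f = trans (cong length (map-tabulate id f)) (length-tabulate f)

nth-map-allFin-< : ∀ {m} (f : Fin m → ℕ) {k} (k<m : k < m) → nth (map f (allFin m)) k ≡ f (fromℕ< k<m)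
nth-map-allFin-< f k<m = trans (cong (nth (map f (allFin _))) (sym (toℕ-fromℕ< k<m))) (nth-map-allFin f (fromℕ< k<m))

Nondecreasing : List ℕ → Set
Nondecreasing xs = ∀ {i} → suc i < length xs → nth xs i ≤ nth xs (suc i)

Nonincreasing : List ℕ → Set
Nonincreasing xs = ∀ {i j} → i ≤ j → j < length xs → nth xs j ≤ nth xs i

UpwardClosed : (ℕ → Bool) → Set
UpwardClosed p = ∀ {s t} → s ≤ t → p s ≡ true → p t ≡ true

map-allFin-nonincreasing : ∀ {m} (f : Fin m → ℕ) → (∀ i j → i Fin.≤ j → f j ≤ f i) → Nonincreasing (map f (allFin m))
map-allFin-nonincreasing {m} f antitone {i} {j} i≤j j<
  rewrite length-map-allFin f | nth-map-allFin-< f j< | nth-map-allFin-< f (≤-<-trans i≤j j<) =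
  antitone _ _ (subst₂ _≤_ (sym (toℕ-fromℕ< _)) (sym (toℕ-fromℕ< j<)) i≤j)

≤ᵇ-upwardClosed : ∀ {m} {f : ℕ → ℕ} → (∀ {s t} → s ≤ t → f s ≤ f t) → UpwardClosed (λ t → m ≤ᵇ f t)
≤ᵇ-upwardClosed {m} f-mono s≤t e = ≤⇒≤ᵇ≡true (≤-trans (≤ᵇ≡true⇒≤ {m} e) (f-mono s≤t))

length-filterᵇ≤ : ∀ {A : Set} (p : A → Bool) xs → length (filterᵇ p xs) ≤ length xs
length-filterᵇ≤ p xs = ≤-trans (≤-reflexive (length-filterᵇ p xs)) (countᵇ≤length p xs)

module _ {p : ℕ → Bool} (p↑ : UpwardClosed p) where

  private
    countᵇ-none-nth : ∀ xs → (∀ {j} → j < length xs → p (nth xs j) ≡ false) → countᵇ p xs ≡ 0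
    countᵇ-none-nth [] _ = refl
    countᵇ-none-nth (x ∷ xs) none rewrite none {0} (s≤s z≤n) = countᵇ-none-nth xs (none ∘ s≤s)

    none-after : ∀ {x xs} → Nonincreasing (x ∷ xs) → p x ≡ false →
      ∀ {k} → k < length (x ∷ xs) → p (nth (x ∷ xs) k) ≡ false
    none-after {x} {xs} dec px {k} k< with p (nth (x ∷ xs) k) in pk
    ... | false = refl
    ... | true with () ← trans (sym (p↑ (dec z≤n k<) pk)) px

  countᵇ-prefix : ∀ xs → Nonincreasing xs → ∀ {k} → k < length xs → p (nth xs k) ≡ (k <ᵇ countᵇ p xs)
  countᵇ-prefix (x ∷ xs) dec {k} k< with p x in px
  countᵇ-prefix (x ∷ xs) dec {zero} k< | true = px
  countᵇ-prefix (x ∷ xs) dec {suc k} (s≤s k<) | true = countᵇ-prefix xs (λ i≤j j< → dec (s≤s i≤j) (s≤s j<)) k<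
  ... | false =
    trans (none-after dec px k<) (cong (k <ᵇ_) (sym (countᵇ-none-nth xs (none-after dec px ∘ s≤s))))

  countᵇ-prefix⁺ : ∀ xs → Nonincreasing xs → ∀ {k} → k < countᵇ p xs → p (nth xs k) ≡ true
  countᵇ-prefix⁺ xs dec k< =
    trans (countᵇ-prefix xs dec (<-≤-trans k< (countᵇ≤length p xs))) (<⇒<ᵇ≡true k<)

  countᵇ-prefix⁻ : ∀ xs → Nonincreasing xs → ∀ {k} → k < length xs → p (nth xs k) ≡ true → k < countᵇ p xs
  countᵇ-prefix⁻ xs dec k< pk = <ᵇ≡true⇒< (trans (sym (countᵇ-prefix xs dec k<)) pk)

boolToℕ : Bool → ℕ
boolToℕ true = 1
boolToℕ false = 0

allFin-suc : ∀ n → allFin (suc n) ≡ Fin.zero ∷ map Fin.suc (allFin n)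
allFin-suc n = cong (Fin.zero ∷_) (sym (map-tabulate id Fin.suc))

countᵇ-∷ : ∀ {A : Set} (p : A → Bool) x xs → countᵇ p (x ∷ xs) ≡ boolToℕ (p x) + countᵇ p xs
countᵇ-∷ p x xs with p x
... | true = refl
... | false = refl

countᵇ-allFin-suc : ∀ {n} (R : Fin (suc n) → Bool) →
  countᵇ R (allFin (suc n)) ≡ boolToℕ (R Fin.zero) + countᵇ (R ∘ Fin.suc) (allFin n)
countᵇ-allFin-suc {n} R = begin
  countᵇ R (allFin (suc n))                                        ≡⟨ cong (countᵇ R) (allFin-suc n) ⟩
  countᵇ R (Fin.zero ∷ map Fin.suc (allFin n))                     ≡⟨ countᵇ-∷ R Fin.zero (map Fin.suc (allFin n)) ⟩
  boolToℕ (R Fin.zero) + countᵇ R (map Fin.suc (allFin n))         ≡⟨ cong (boolToℕ (R Fin.zero) +_) (countᵇ-map R Fin.suc (allFin n)) ⟩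
  boolToℕ (R Fin.zero) + countᵇ (R ∘ Fin.suc) (allFin n)           ∎
  where open ≡-Reasoning

countᵇ-allFin-≢ : ∀ {n} (R : Fin n → Bool) i →
  countᵇ (λ k → R k ∧ not (does (k Fin.≟ i))) (allFin n) + boolToℕ (R i) ≡ countᵇ R (allFin n)
countᵇ-allFin-≢ {suc n} R Fin.zero
  rewrite countᵇ-allFin-suc (λ k → R k ∧ not (does (k Fin.≟ Fin.zero))) | countᵇ-allFin-suc R
        | ∧-zeroʳ (R Fin.zero) | countᵇ-cong (allFin n) (λ k → ∧-identityʳ (R (Fin.suc k))) =
  +-comm (countᵇ (R ∘ Fin.suc) (allFin n)) (boolToℕ (R Fin.zero))
countᵇ-allFin-≢ {suc n} R (Fin.suc i)
  rewrite countᵇ-allFin-suc (λ k → R k ∧ not (does (k Fin.≟ Fin.suc i))) | countᵇ-allFin-suc R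
        | ∧-identityʳ (R Fin.zero) =
  trans (+-assoc (boolToℕ (R Fin.zero)) _ _) (cong (boolToℕ (R Fin.zero) +_) (countᵇ-allFin-≢ (R ∘ Fin.suc) i))

filterᵇ-cong : ∀ {A : Set} {p q : A → Bool} xs → (∀ x → p x ≡ q x) → filterᵇ p xs ≡ filterᵇ q xs
filterᵇ-cong [] _ = refl
filterᵇ-cong {q = q} (x ∷ xs) p≗q rewrite p≗q x with q x
... | true = cong (x ∷_) (filterᵇ-cong xs p≗q)
... | false = filterᵇ-cong xs p≗q

filterᵇ-map : ∀ {A B : Set} (p : B → Bool) (f : A → B) xs → filterᵇ p (map f xs) ≡ map f (filterᵇ (p ∘ f) xs)
filterᵇ-map p f [] = refl
filterᵇ-map p f (x ∷ xs) with p (f x)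
... | true = cong (f x ∷_) (filterᵇ-map p f xs)
... | false = filterᵇ-map p f xs

filterᵇ-none : ∀ {A : Set} {p : A → Bool} xs → (∀ x → p x ≡ false) → filterᵇ p xs ≡ []
filterᵇ-none [] _ = refl
filterᵇ-none (x ∷ xs) none rewrite none x = filterᵇ-none xs none

all-true : ∀ {A : Set} {p : A → Bool} xs → (∀ x → p x ≡ true) → all p xs ≡ true
all-true [] _ = refl
all-true (x ∷ xs) holds rewrite holds x = all-true xs holds

all-false : ∀ {A : Set} {p : A → Bool} {x xs} → x ∈ xs → p x ≡ false → all p xs ≡ false
all-false {p = p} {xs = y ∷ xs} (here refl) px rewrite px = refl
all-false {p = p} {xs = y ∷ xs} (there x∈) px with p y
... | true = all-false x∈ px
... | false = refl

all-cong : ∀ {A : Set} {p q : A → Bool} xs → (∀ x → p x ≡ q x) → all p xs ≡ all q xs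
all-cong [] _ = refl
all-cong (x ∷ xs) p≗q = cong₂ _∧_ (p≗q x) (all-cong xs p≗q)

any-map : ∀ {A B : Set} (p : B → Bool) (f : A → B) xs → any p (map f xs) ≡ any (p ∘ f) xs
any-map p f [] = refl
any-map p f (x ∷ xs) = cong (p (f x) ∨_) (any-map p f xs)

any-filterᵇ : ∀ {A : Set} (q R : A → Bool) xs → any q (filterᵇ R xs) ≡ any (λ x → R x ∧ q x) xs
any-filterᵇ q R [] = refl
any-filterᵇ q R (x ∷ xs) with R x
... | true = cong (q x ∨_) (any-filterᵇ q R xs)
... | false = any-filterᵇ q R xs

any-none : ∀ {A : Set} {p : A → Bool} xs → (∀ x → p x ≡ false) → any p xs ≡ false
any-none [] _ = refl
any-none (x ∷ xs) none rewrite none x = any-none xs none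

any-allFin-≡ : ∀ {n} (R : Fin n → Bool) i → any (λ k → R k ∧ does (i Fin.≟ k)) (allFin n) ≡ R i
any-allFin-≡ {suc n} R i = begin
  any p (allFin (suc n))                                         ≡⟨ cong (any p) (allFin-suc n) ⟩
  p Fin.zero ∨ any p (map Fin.suc (allFin n))                    ≡⟨ cong (p Fin.zero ∨_) (any-map p Fin.suc (allFin n)) ⟩
  p Fin.zero ∨ any (p ∘ Fin.suc) (allFin n)                      ≡⟨ go i ⟩
  R i                                                            ∎
  where
  open ≡-Reasoning
  p : Fin (suc n) → Bool
  p = λ k → R k ∧ does (i Fin.≟ k)
  go : ∀ i → (R Fin.zero ∧ does (i Fin.≟ Fin.zero)) ∨ any (λ k → R (Fin.suc k) ∧ does (i Fin.≟ Fin.suc k)) (allFin n) ≡ R i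
  go Fin.zero rewrite ∧-identityʳ (R Fin.zero) | any-none (allFin n) (λ k → ∧-zeroʳ (R (Fin.suc k))) = ∨-identityʳ (R Fin.zero)
  go (Fin.suc i) rewrite ∧-zeroʳ (R Fin.zero) = any-allFin-≡ (R ∘ Fin.suc) i

inRange : ℕ → ℕ → ℕ → Bool
inRange lo hi t = not (t <ᵇ lo) ∧ (t <ᵇ hi)

countᵇ-inRange : ∀ {n lo hi} → lo ≤ hi → hi ≤ n → countᵇ (inRange lo hi ∘ toℕ) (allFin n) ≡ hi ∸ lo
countᵇ-inRange {zero} z≤n z≤n = refl
countᵇ-inRange {suc n} {zero} {zero} _ _ = countᵇ-none (allFin (suc n)) (λ _ → refl)
countᵇ-inRange {suc n} {zero} {suc hi} _ (s≤s hi≤n) =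
  trans (countᵇ-allFin-suc {n} (inRange 0 (suc hi) ∘ toℕ)) (cong suc (countᵇ-inRange z≤n hi≤n))
countᵇ-inRange {suc n} {suc lo} {suc hi} (s≤s lo≤hi) (s≤s hi≤n) =
  trans (countᵇ-allFin-suc {n} (inRange (suc lo) (suc hi) ∘ toℕ)) (countᵇ-inRange lo≤hi hi≤n)

Unique-++⁻ˡ : ∀ {A : Set} (xs : List A) {ys} → Unique (xs ++ ys) → Unique xs
Unique-++⁻ˡ [] _ = []
Unique-++⁻ˡ (x ∷ xs) (x∉ ∷ u) = ++⁻ˡ xs x∉ ∷ Unique-++⁻ˡ xs u

Unique-length≤ : ∀ {m} {xs : List ℕ} → Unique xs → All (_< m) xs → length xs ≤ m
Unique-length≤ {zero} {[]} _ _ = z≤n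
Unique-length≤ {zero} {_ ∷ _} _ (() ∷ _)
Unique-length≤ {suc m} {xs} u xs<m =
  ≤-trans (length≤1+others u) (s≤s (Unique-length≤ (Unique.filter⁺ (¬? ∘ (_≟ m)) u) (others<m xs<m)))
  where
  others : List ℕ → List ℕ
  others = filter (¬? ∘ (_≟ m))
  length≤1+others : ∀ {ys} → Unique ys → length ys ≤ suc (length (others ys))
  length≤1+others {[]} _ = z≤n
  length≤1+others {y ∷ ys} (y∉ys ∷ u) with y ≟ m
  ... | yes refl = begin
    suc (length ys)
      ≡⟨ cong (suc ∘ length) (filter-all (¬? ∘ (_≟ m)) (All.map (λ m≢z z≡m → m≢z (sym z≡m)) y∉ys)) ⟨
    suc (length (others ys))                       ≡⟨ cong (suc ∘ length) (filter-reject (¬? ∘ (_≟ m)) (λ m≢m → m≢m refl)) ⟨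
    suc (length (others (m ∷ ys)))                 ∎
    where open ≤-Reasoning
  ... | no y≢m = begin
    suc (length ys)                                ≤⟨ s≤s (length≤1+others u) ⟩
    suc (length (y ∷ others ys))                   ≡⟨ cong (suc ∘ length) (filter-accept (¬? ∘ (_≟ m)) y≢m) ⟨
    suc (length (others (y ∷ ys)))                 ∎
    where open ≤-Reasoning
  others<m : ∀ {ys} → All (_< suc m) ys → All (_< m) (others ys)
  others<m [] = []
  others<m {y ∷ ys} (y<1+m ∷ ys<) with y ≟ m
  ... | yes y≡m rewrite filter-reject (¬? ∘ (_≟ m)) {y} {ys} (λ y≢m → y≢m y≡m) = others<m ys<
  ... | no y≢m rewrite filter-accept (¬? ∘ (_≟ m)) {y} {ys} y≢m = ≤∧≢⇒< (≤-pred y<1+m) y≢m ∷ others<m ys<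

nth-reverse-++ : ∀ xs t {i} → i < length xs → nth (reverse xs ++ [ t ]) i ≡ nth xs (length xs ∸ suc i)
nth-reverse-++ xs t {i} i< =
  trans (nth-++ˡ (reverse xs) [ t ] (subst (i <_) (sym (length-reverse xs)) i<)) (nth-reverse xs i<)

nth-reverse-++-last : ∀ xs t → nth (reverse xs ++ [ t ]) (length xs) ≡ t
nth-reverse-++-last xs t = subst (λ m → nth (reverse xs ++ [ t ]) m ≡ t) (length-reverse xs) (nth-++ʳ (reverse xs) [ t ])

reverse-nonincreasing : ∀ {xs t} → Nonincreasing xs → (∀ {k} → k < length xs → nth xs k ≤ t) → Nondecreasing (reverse xs ++ [ t ])
reverse-nonincreasing {xs} {t} dec ≤t {i} 1+i< with m≤n⇒m<n∨m≡n (≤-pred (subst (suc i <_) |xs++t| 1+i<))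
  where
  |xs++t| : length (reverse xs ++ [ t ]) ≡ suc (length xs)
  |xs++t| = trans (length-++ (reverse xs)) (trans (cong (_+ 1) (length-reverse xs)) (+-comm (length xs) 1))
... | inj₁ 1+i<|xs| = begin
  nth (reverse xs ++ [ t ]) i                   ≡⟨ nth-reverse-++ xs t (<-trans (n<1+n i) 1+i<|xs|) ⟩
  nth xs (length xs ∸ suc i)
    ≤⟨ dec (∸-monoʳ-≤ (length xs) (n≤1+n (suc i))) (∸-monoʳ-< {o = 0} (s≤s z≤n) (<⇒≤ 1+i<|xs|)) ⟩
  nth xs (length xs ∸ suc (suc i))              ≡⟨ nth-reverse-++ xs t 1+i<|xs| ⟨
  nth (reverse xs ++ [ t ]) (suc i)             ∎
  where open ≤-Reasoning
... | inj₂ 1+i≡|xs| = begin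
  nth (reverse xs ++ [ t ]) i                   ≡⟨ nth-reverse-++ xs t (subst (i <_) 1+i≡|xs| ≤-refl) ⟩
  nth xs (length xs ∸ suc i)                    ≡⟨ cong (λ m → nth xs (m ∸ suc i)) 1+i≡|xs| ⟨
  nth xs (suc i ∸ suc i)                        ≡⟨ cong (nth xs) (n∸n≡0 i) ⟩
  nth xs 0                                      ≤⟨ ≤t (subst (0 <_) 1+i≡|xs| (s≤s z≤n)) ⟩
  t                                             ≡⟨ nth-reverse-++-last xs t ⟨
  nth (reverse xs ++ [ t ]) (length xs)         ≡⟨ cong (nth (reverse xs ++ [ t ])) 1+i≡|xs| ⟨
  nth (reverse xs ++ [ t ]) (suc i)             ∎
  where open ≤-Reasoning

zipWith-applyUpTo : ∀ {A B C : Set} (f : A → B → C) (g : ℕ → A) (h : ℕ → B) m →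
  zipWith f (applyUpTo g m) (applyUpTo h m) ≡ applyUpTo (λ x → f (g x) (h x)) m
zipWith-applyUpTo f g h zero = refl
zipWith-applyUpTo f g h (suc m) = cong (f (g 0) (h 0) ∷_) (zipWith-applyUpTo f (g ∘ suc) (h ∘ suc) m)

pt : ℕ → ℕ → Point
pt x y = (ℤ.+ x , ℤ.+ y)

pt-injective : ∀ {x y x′ y′} → pt x y ≡ pt x′ y′ → x ≡ x′ × y ≡ y′
pt-injective refl = refl , refl

pt⊕n : ∀ x y → pt x y ⊕ vec stN ≡ pt x (suc y)
pt⊕n x y rewrite +-identityʳ x | +-comm y 1 = refl

pt⊕e : ∀ x y → pt x y ⊕ vec stE ≡ pt (suc x) y
pt⊕e x y rewrite +-identityʳ y | +-comm x 1 = refl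

pt⊕se : ∀ x y → pt x (suc y) ⊕ vec stSE ≡ pt (suc x) y
pt⊕se x y rewrite +-comm x 1 = refl

pt⊕nw : ∀ x y → pt (suc x) y ⊕ vec stNW ≡ pt x (suc y)
pt⊕nw x y rewrite +-comm y 1 = refl

pt⊕s : ∀ x y → pt x (suc y) ⊕ vec stS ≡ pt x y
pt⊕s x y rewrite +-identityʳ x = refl

record Ray (s : Step) : Set where
  field
    line : ℕ → Point
    advance : ∀ j → line j ⊕ vec s ≡ line (suc j)

  tail : Ray s
  tail = record { line = line ∘ suc ; advance = advance ∘ suc }

open Ray

vertical : ∀ x y → Ray stN
vertical x y = record { line = λ j → pt x (j + y) ; advance = λ j → pt⊕n x (j + y) }

horizontal : ∀ x y → Ray stE
horizontal x y = record { line = λ j → pt (j + x) y ; advance = λ j → pt⊕e (j + x) y }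

stepHeights : (Step → Bool) → Point → List Step → List ℤ.ℤ
stepHeights f p ss = map (proj₂ ∘ proj₁) (filterᵇ (f ∘ proj₂) (zip (points p ss) ss))

stepHeights-∷ : ∀ f p s ss → stepHeights f p (s ∷ ss) ≡
  (if f s then proj₂ p ∷ stepHeights f (p ⊕ vec s) ss else stepHeights f (p ⊕ vec s) ss)
stepHeights-∷ f p s ss with f s
... | true = refl
... | false = refl

module _ {s : Step} where

  ∈-points-replicate⁻ : ∀ (ray : Ray s) k rest {q} → q ∈ points (line ray 0) (replicate k s ++ rest) →
    (∃[ j ] j ≤ k × q ≡ line ray j) ⊎ q ∈ points (line ray k) rest
  ∈-points-replicate⁻ ray zero rest q∈ = inj₂ q∈
  ∈-points-replicate⁻ ray (suc k) rest (here q≡) = inj₁ (0 , z≤n , q≡)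
  ∈-points-replicate⁻ ray (suc k) rest (there q∈)
    with ∈-points-replicate⁻ (tail ray) k rest (subst (λ p → _ ∈ points p _) (advance ray 0) q∈)
  ... | inj₁ (j , j≤k , q≡) = inj₁ (suc j , s≤s j≤k , q≡)
  ... | inj₂ q∈rest = inj₂ q∈rest

  ∈-points-replicate⁺ : ∀ (ray : Ray s) k rest {j} → j ≤ k → line ray j ∈ points (line ray 0) (replicate k s ++ rest)
  ∈-points-replicate⁺ ray zero (_ ∷ _) z≤n = here refl
  ∈-points-replicate⁺ ray zero [] z≤n = here refl
  ∈-points-replicate⁺ ray (suc k) rest {zero} _ = here refl
  ∈-points-replicate⁺ ray (suc k) rest {suc j} (s≤s j≤k) =
    there (subst (λ p → _ ∈ points p _) (sym (advance ray 0)) (∈-points-replicate⁺ (tail ray) k rest j≤k))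

  ∈-points-replicate⁺ʳ : ∀ (ray : Ray s) k rest {q} → q ∈ points (line ray k) rest →
    q ∈ points (line ray 0) (replicate k s ++ rest)
  ∈-points-replicate⁺ʳ ray zero rest q∈ = q∈
  ∈-points-replicate⁺ʳ ray (suc k) rest q∈ =
    there (subst (λ p → _ ∈ points p _) (sym (advance ray 0)) (∈-points-replicate⁺ʳ (tail ray) k rest q∈))

  endPt-replicate : ∀ (ray : Ray s) k rest → endPt (line ray 0) (replicate k s ++ rest) ≡ endPt (line ray k) rest
  endPt-replicate ray zero rest = refl
  endPt-replicate ray (suc k) rest =
    trans (cong (λ p → endPt p (replicate k s ++ rest)) (advance ray 0)) (endPt-replicate (tail ray) k rest)

  stepHeights-replicate-skip : ∀ {f} → f s ≡ false → ∀ (ray : Ray s) k rest →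
    stepHeights f (line ray 0) (replicate k s ++ rest) ≡ stepHeights f (line ray k) rest
  stepHeights-replicate-skip fs ray zero rest = refl
  stepHeights-replicate-skip {f} fs ray (suc k) rest
    rewrite stepHeights-∷ f (line ray 0) s (replicate k s ++ rest) | fs | advance ray 0 =
    stepHeights-replicate-skip fs (tail ray) k rest

  stepHeights-replicate-keep : ∀ {f} → f s ≡ true → ∀ (ray : Ray s) k rest →
    stepHeights f (line ray 0) (replicate k s ++ rest) ≡ applyUpTo (proj₂ ∘ line ray) k ++ stepHeights f (line ray k) rest
  stepHeights-replicate-keep fs ray zero rest = refl
  stepHeights-replicate-keep {f} fs ray (suc k) rest
    rewrite stepHeights-∷ f (line ray 0) s (replicate k s ++ rest) | fs | advance ray 0 =
    cong (proj₂ (line ray 0) ∷_) (stepHeights-replicate-keep fs (tail ray) k rest)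

elemP-∈ : ∀ {p xs} → p ∈ xs → elemP p xs ≡ true
elemP-∈ {p} {x ∷ xs} (here p≡x) rewrite dec-true (≡-dec ℤ._≟_ ℤ._≟_ p x) p≡x = refl
elemP-∈ {p} {x ∷ xs} (there p∈) with does (≡-dec ℤ._≟_ ℤ._≟_ p x)
... | true = refl
... | false = elemP-∈ p∈

elemP-∉ : ∀ {p xs} → p ∉ xs → elemP p xs ≡ false
elemP-∉ {p} {[]} _ = refl
elemP-∉ {p} {x ∷ xs} p∉ rewrite dec-false (≡-dec ℤ._≟_ ℤ._≟_ p x) (p∉ ∘ here) = elemP-∉ (p∉ ∘ there)

module _ {x y₀ y₁ : ℕ} (k : ℕ) (rest : List Step) (k+y₀≡1+y₁ : k + y₀ ≡ suc y₁) where

  private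
    column : List Step
    column = replicate k stN ++ stSE ∷ rest

    top≡ : pt x (k + y₀) ≡ pt x (suc y₁)
    top≡ = cong (pt x) k+y₀≡1+y₁

    se : ∀ {q} → q ∈ points (pt x (suc y₁) ⊕ vec stSE) rest → q ∈ points (pt (suc x) y₁) rest
    se {q} = subst (λ p → q ∈ points p rest) (pt⊕se x y₁)

  ∈-column⁻ : ∀ {q} → q ∈ points (pt x y₀) column →
    (∃[ y ] q ≡ pt x y × y₀ ≤ y × y ≤ suc y₁) ⊎ q ∈ points (pt (suc x) y₁) rest
  ∈-column⁻ {q} q∈ with ∈-points-replicate⁻ (vertical x y₀) k (stSE ∷ rest) q∈
  ... | inj₁ (j , j≤k , q≡) = inj₁ (j + y₀ , q≡ , m≤n+m y₀ j , ≤-trans (+-monoˡ-≤ y₀ j≤k) (≤-reflexive k+y₀≡1+y₁))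
  ... | inj₂ q∈′ with subst (λ p → q ∈ points p (stSE ∷ rest)) top≡ q∈′
  ...   | here q≡ = inj₁ (suc y₁ , q≡ , subst (y₀ ≤_) k+y₀≡1+y₁ (m≤n+m y₀ k) , ≤-refl)
  ...   | there q∈″ = inj₂ (se q∈″)

  ∈-column⁺ : ∀ {y} → y₀ ≤ y → y ≤ suc y₁ → pt x y ∈ points (pt x y₀) column
  ∈-column⁺ {y} y₀≤y y≤1+y₁ = subst (λ j → pt x j ∈ points (pt x y₀) column) (m∸n+n≡m y₀≤y)
    (∈-points-replicate⁺ (vertical x y₀) k (stSE ∷ rest) y∸y₀≤k)
    where
    y∸y₀≤k : y ∸ y₀ ≤ k
    y∸y₀≤k = subst (y ∸ y₀ ≤_) (m+n∸n≡m k y₀) (∸-monoˡ-≤ y₀ (subst (y ≤_) (sym k+y₀≡1+y₁) y≤1+y₁))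

  ∈-column⁺ʳ : ∀ {q} → q ∈ points (pt (suc x) y₁) rest → q ∈ points (pt x y₀) column
  ∈-column⁺ʳ {q} q∈ = ∈-points-replicate⁺ʳ (vertical x y₀) k (stSE ∷ rest)
    (subst (λ p → q ∈ points p (stSE ∷ rest)) (sym top≡) (there (subst (λ p → q ∈ points p rest) (sym (pt⊕se x y₁)) q∈)))

  endPt-column : endPt (pt x y₀) column ≡ endPt (pt (suc x) y₁) rest
  endPt-column = trans (endPt-replicate (vertical x y₀) k (stSE ∷ rest))
    (trans (cong (λ p → endPt p (stSE ∷ rest)) top≡) (cong (λ p → endPt p rest) (pt⊕se x y₁)))

  stepHeights-column : stepHeights isSE (pt x y₀) column ≡ ℤ.+ suc y₁ ∷ stepHeights isSE (pt (suc x) y₁) rest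
  stepHeights-column = trans (stepHeights-replicate-skip {f = isSE} refl (vertical x y₀) k (stSE ∷ rest))
    (trans (cong (λ p → stepHeights isSE p (stSE ∷ rest)) top≡) (cong (λ p → ℤ.+ suc y₁ ∷ stepHeights isSE p rest) (pt⊕se x y₁)))

-- The upper path

-- Column x of uppSteps n d (r ∷ rs) climbs the antidiagonals x + y from floor r rs x up to
-- 2 + nth (levels r rs) x.

module UpperPath (n d top : ℕ) (d+n≡1+top : d + n ≡ suc top) where

  levels : ℕ → List ℕ → List ℕ
  levels prev rs = prev ∷ rs ++ [ top ]

  AboveAxis : ℕ → ℕ → List ℕ → Set
  AboveAxis x₀ prev rs = ∀ {i} → i ≤ length rs → i + x₀ ≤ suc (nth (levels prev rs) (suc i))

  UpperPoint : ℕ → ℕ → List ℕ → ℕ → ℕ → Set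
  UpperPoint x₀ prev rs i y =
    (i ≤ length rs × 2 + nth (levels prev rs) i ≤ i + x₀ + y) ⊎ (i ≡ suc (length rs) × i + x₀ + y ≡ 2 + top)

  private
    rest : ℕ → List ℕ → List Step
    rest prev [] = []
    rest prev (r ∷ rs) = uppGo n d r rs

    steps : ℕ → List ℕ → ℕ
    steps prev rs = nth (levels prev rs) 1 ∸ prev

    uppGo-column : ∀ prev rs → uppGo n d prev rs ≡ replicate (steps prev rs) stN ++ stSE ∷ rest prev rs
    uppGo-column prev [] = cong (λ k → replicate k stN ++ stSE ∷ []) (cong (_∸ suc prev) d+n≡1+top)
    uppGo-column prev (r ∷ rs) = refl

    column-height : ∀ {x₀ y₀ prev e} → x₀ + y₀ ≡ 2 + prev → prev ≤ e → x₀ ≤ suc e → (e ∸ prev) + y₀ ≡ suc (suc e ∸ x₀)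
    column-height {x₀} {y₀} {prev} {e} x₀+y₀≡ prev≤e x₀≤1+e = +-cancelˡ-≡ x₀ _ _ (begin
      x₀ + ((e ∸ prev) + y₀)   ≡⟨ x∙yz≈y∙xz x₀ (e ∸ prev) y₀ ⟩
      (e ∸ prev) + (x₀ + y₀)   ≡⟨ cong ((e ∸ prev) +_) x₀+y₀≡ ⟩
      (e ∸ prev) + (2 + prev)  ≡⟨ x∙yz≈y∙xz (e ∸ prev) 2 prev ⟩
      2 + ((e ∸ prev) + prev)  ≡⟨ cong (λ m → 2 + m) (m∸n+n≡m prev≤e) ⟩
      2 + e                    ≡⟨ cong suc (m+[n∸m]≡n x₀≤1+e) ⟨
      suc (x₀ + (suc e ∸ x₀))  ≡⟨ +-suc x₀ _ ⟨
      x₀ + suc (suc e ∸ x₀)    ∎)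
      where open ≡-Reasoning

    next-column : ∀ {x₀ e} → x₀ ≤ suc e → suc x₀ + (suc e ∸ x₀) ≡ 2 + e
    next-column x₀≤1+e = cong suc (m+[n∸m]≡n x₀≤1+e)

    shift : ∀ i x₀ y → pt (i + suc x₀) y ≡ pt (suc i + x₀) y
    shift i x₀ y = cong (λ x → pt x y) (+-suc i x₀)

    shift-sum : ∀ i x₀ y → i + suc x₀ + y ≡ suc i + x₀ + y
    shift-sum i x₀ y = cong (_+ y) (+-suc i x₀)

  record Columns (x₀ y₀ prev : ℕ) (rs : List ℕ) : Set where
    field
      start : x₀ + y₀ ≡ 2 + prev
      mono : Nondecreasing (levels prev rs)
      above : AboveAxis x₀ prev rs

    private
      e : ℕ
      e = nth (levels prev rs) 1

    x₀≤1+e : x₀ ≤ suc e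
    x₀≤1+e = above z≤n

    column-top : (e ∸ prev) + y₀ ≡ suc (suc e ∸ x₀)
    column-top = column-height start (mono (s≤s (non-empty rs))) x₀≤1+e
      where
      non-empty : ∀ rs → 1 ≤ length (rs ++ [ top ])
      non-empty [] = s≤s z≤n
      non-empty (_ ∷ _) = s≤s z≤n

  open Columns

  next : ∀ {x₀ y₀ prev r rs} → Columns x₀ y₀ prev (r ∷ rs) → Columns (suc x₀) (suc r ∸ x₀) r rs
  next {r = r} {rs} h = record
    { start = next-column (x₀≤1+e h)
    ; mono = mono h ∘ s≤s
    ; above = λ {i} i≤ → subst (λ x → x ≤ suc (nth (levels r rs) (suc i))) (sym (+-suc i _)) (above h (s≤s i≤))
    }

  ∈-uppGo⁻ : ∀ {x₀ y₀} prev rs → Columns x₀ y₀ prev rs → ∀ {q} → q ∈ points (pt x₀ y₀) (uppGo n d prev rs) →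
    ∃[ i ] ∃[ y ] q ≡ pt (i + x₀) y × UpperPoint x₀ prev rs i y
  ∈-uppGo⁻ {x₀} {y₀} prev rs h {q} q∈
    with ∈-column⁻ {x₀} (steps prev rs) (rest prev rs) (column-top h) (subst (λ ss → q ∈ points (pt x₀ y₀) ss) (uppGo-column prev rs) q∈)
  ... | inj₁ (y , q≡ , y₀≤y , _) = 0 , y , q≡ , inj₁ (z≤n , subst (_≤ x₀ + y) (start h) (+-monoʳ-≤ x₀ y₀≤y))
  ∈-uppGo⁻ prev [] h q∈ | inj₂ (here q≡) = 1 , _ , q≡ , inj₂ (refl , next-column (x₀≤1+e h))
  ∈-uppGo⁻ {x₀} prev (r ∷ rs) h q∈ | inj₂ q∈′ with ∈-uppGo⁻ r rs (next h) q∈′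
  ... | i , y , q≡ , inj₁ (i≤ , lower) =
    suc i , y , trans q≡ (shift i x₀ y) , inj₁ (s≤s i≤ , subst (2 + nth (levels r rs) i ≤_) (shift-sum i x₀ y) lower)
  ... | i , y , q≡ , inj₂ (i≡ , final) = suc i , y , trans q≡ (shift i x₀ y) , inj₂ (cong suc i≡ , trans (sym (shift-sum i x₀ y)) final)

  ∈-uppGo⁺ : ∀ {x₀ y₀} prev rs → Columns x₀ y₀ prev rs → ∀ {i y} → i ≤ length rs →
    2 + nth (levels prev rs) i ≤ i + x₀ + y → i + x₀ + y ≤ 2 + nth (levels prev rs) (suc i) →
    pt (i + x₀) y ∈ points (pt x₀ y₀) (uppGo n d prev rs)
  ∈-uppGo⁺ {x₀} {y₀} prev rs h {zero} {y} _ lower upper =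
    subst (λ ss → pt x₀ y ∈ points (pt x₀ y₀) ss) (sym (uppGo-column prev rs))
      (∈-column⁺ {x₀} (steps prev rs) (rest prev rs) (column-top h) y₀≤y y≤top)
    where
    y₀≤y : y₀ ≤ y
    y₀≤y = +-cancelˡ-≤ x₀ y₀ y (subst (_≤ x₀ + y) (sym (start h)) lower)
    y≤top : y ≤ suc (suc (nth (levels prev rs) 1) ∸ x₀)
    y≤top = +-cancelˡ-≤ x₀ y _ (subst (x₀ + y ≤_) (trans (sym (next-column (x₀≤1+e h))) (sym (+-suc x₀ _))) upper)
  ∈-uppGo⁺ {x₀} {y₀} prev (r ∷ rs) h {suc i} {y} (s≤s i≤) lower upper =
    ∈-column⁺ʳ {x₀} (steps prev (r ∷ rs)) (uppGo n d r rs) (column-top h)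
      (subst (λ p → p ∈ points (pt (suc x₀) (suc r ∸ x₀)) (uppGo n d r rs)) (shift i x₀ y)
        (∈-uppGo⁺ r rs (next h) i≤ (subst (2 + nth (levels r rs) i ≤_) (sym (shift-sum i x₀ y)) lower)
                                   (subst (_≤ 2 + nth (levels r rs) (suc i)) (sym (shift-sum i x₀ y)) upper)))

  endPt-uppGo : ∀ {x₀ y₀} prev rs → Columns x₀ y₀ prev rs →
    ∃[ y ] endPt (pt x₀ y₀) (uppGo n d prev rs) ≡ pt (suc (length rs) + x₀) y × suc (length rs) + x₀ + y ≡ 2 + top
  endPt-uppGo {x₀} {y₀} prev [] h =
    _ , trans (cong (endPt (pt x₀ y₀)) (uppGo-column prev [])) (endPt-column {x₀} (steps prev []) [] (column-top h)) , next-column (x₀≤1+e h)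
  endPt-uppGo {x₀} {y₀} prev (r ∷ rs) h with endPt-uppGo r rs (next h)
  ... | y , end≡ , final = y ,
    trans (endPt-column {x₀} (steps prev (r ∷ rs)) (uppGo n d r rs) (column-top h))
          (trans end≡ (shift (suc (length rs)) x₀ y)) ,
    trans (sym (shift-sum (suc (length rs)) x₀ y)) final

  stepHeights-uppGo : ∀ {x₀ y₀} prev rs → Columns x₀ y₀ prev rs →
    stepHeights isSE (pt x₀ y₀) (uppGo n d prev rs) ≡
    applyUpTo (λ i → ℤ.+ suc (suc (nth (levels prev rs) (suc i)) ∸ (i + x₀))) (suc (length rs))
  stepHeights-uppGo {x₀} {y₀} prev [] h =
    trans (cong (stepHeights isSE (pt x₀ y₀)) (uppGo-column prev [])) (stepHeights-column {x₀} (steps prev []) [] (column-top h))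
  stepHeights-uppGo {x₀} {y₀} prev (r ∷ rs) h =
    trans (stepHeights-column {x₀} (steps prev (r ∷ rs)) (uppGo n d r rs) (column-top h))
      (cong (_ ∷_) (trans (stepHeights-uppGo r rs (next h))
        (applyUpTo-cong (suc (length rs)) (λ {i} _ → cong (λ x → ℤ.+ suc (suc (nth (levels r rs) (suc i)) ∸ x)) (+-suc i x₀)))))

  floor : ℕ → List ℕ → ℕ → ℕ
  floor r rs zero = 0
  floor r rs (suc x) = 2 + nth (levels r rs) x

  module _ {r rs} (1+|rs|≡n : suc (length rs) ≡ n) (h : Columns 1 (suc r) r rs) where

    private
      U : List Step
      U = uppSteps n d (r ∷ rs)

      column₀ : 2 + r + 0 ≡ suc (suc r)
      column₀ = +-identityʳ (2 + r)

      +1≡suc : ∀ i → i + 1 ≡ suc i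
      +1≡suc i = +-comm i 1

      final-height : ∀ {y} → suc n + y ≡ 2 + top → y ≡ d
      final-height {y} eq = +-cancelˡ-≡ n y d (suc-injective (trans eq (cong suc (trans (sym d+n≡1+top) (+-comm d n)))))

    ∈-upper⁻ : ∀ {q} → q ∈ points origin U → (∃[ x ] ∃[ y ] q ≡ pt x y × x ≤ n × floor r rs x ≤ x + y) ⊎ q ≡ pt (suc n) d
    ∈-upper⁻ q∈ with ∈-column⁻ {0} (2 + r) (uppGo n d r rs) column₀ q∈
    ... | inj₁ (y , q≡ , _) = inj₁ (0 , y , q≡ , z≤n , z≤n)
    ... | inj₂ q∈′ with ∈-uppGo⁻ r rs h q∈′
    ...   | i , y , q≡ , inj₁ (i≤ , lower) =
      inj₁ (suc i , y , trans q≡ (cong (λ x → pt x y) (+1≡suc i)) ,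
            subst (suc i ≤_) 1+|rs|≡n (s≤s i≤) , subst (λ x → 2 + nth (levels r rs) i ≤ x + y) (+1≡suc i) lower)
    ...   | i , y , q≡ , inj₂ (refl , final) =
      inj₂ (trans q≡ (cong₂ pt x≡ (final-height (subst (λ x → x + y ≡ 2 + top) x≡ final))))
      where
      x≡ : suc (length rs) + 1 ≡ suc n
      x≡ = trans (+1≡suc (suc (length rs))) (cong suc 1+|rs|≡n)

    ∈-upper⁺ : ∀ {x y} → x ≤ n → floor r rs x ≤ x + y → x + y ≤ 2 + nth (levels r rs) x → pt x y ∈ points origin U
    ∈-upper⁺ {zero} {y} _ _ upper = ∈-column⁺ {0} (2 + r) (uppGo n d r rs) column₀ z≤n upper
    ∈-upper⁺ {suc i} {y} x≤n lower upper =
      ∈-column⁺ʳ {0} (2 + r) (uppGo n d r rs) column₀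
        (subst (λ x → pt x y ∈ points (pt 1 (suc r)) (uppGo n d r rs)) (+1≡suc i)
          (∈-uppGo⁺ r rs h (≤-pred (subst (suc i ≤_) (sym 1+|rs|≡n) x≤n))
            (subst (λ x → 2 + nth (levels r rs) i ≤ x + y) (sym (+1≡suc i)) lower)
            (subst (λ x → x + y ≤ 2 + nth (levels r rs) (suc i)) (sym (+1≡suc i)) upper)))

    endPt-upper : endPt origin U ≡ pt (suc n) d
    endPt-upper with endPt-uppGo r rs h
    ... | y , end≡ , final = trans (endPt-column {0} (2 + r) (uppGo n d r rs) column₀)
      (trans end≡ (cong₂ pt x≡ (final-height (subst (λ x → x + y ≡ 2 + top) x≡ final))))
      where
      x≡ : suc (length rs) + 1 ≡ suc n
      x≡ = trans (+1≡suc (suc (length rs))) (cong suc 1+|rs|≡n)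

    stepHeights-upper : stepHeights isSE origin U ≡ applyUpTo (λ x → ℤ.+ suc (suc (nth (levels r rs) x) ∸ x)) (suc n)
    stepHeights-upper = begin
      stepHeights isSE origin U
        ≡⟨ stepHeights-column {0} (2 + r) (uppGo n d r rs) column₀ ⟩
      ℤ.+ suc (suc r) ∷ stepHeights isSE (pt 1 (suc r)) (uppGo n d r rs)
        ≡⟨ cong (ℤ.+ suc (suc r) ∷_) (stepHeights-uppGo r rs h) ⟩
      ℤ.+ suc (suc r) ∷ applyUpTo (λ i → ℤ.+ suc (suc (nth (levels r rs) (suc i)) ∸ (i + 1))) (suc (length rs))
        ≡⟨ cong (ℤ.+ suc (suc r) ∷_) (applyUpTo-cong (suc (length rs))
             (λ {i} _ → cong (λ x → ℤ.+ suc (suc (nth (levels r rs) (suc i)) ∸ x)) (+1≡suc i))) ⟩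
      applyUpTo (λ x → ℤ.+ suc (suc (nth (levels r rs) x) ∸ x)) (suc (suc (length rs)))
        ≡⟨ cong (λ m → applyUpTo (λ x → ℤ.+ suc (suc (nth (levels r rs) x) ∸ x)) (suc m)) 1+|rs|≡n ⟩
      applyUpTo (λ x → ℤ.+ suc (suc (nth (levels r rs) x) ∸ x)) (suc n) ∎
      where open ≡-Reasoning

  uppGo-steps : ∀ prev rs → All (λ s → s ≡ stN ⊎ s ≡ stSE) (uppGo n d prev rs)
  uppGo-steps prev [] = ++⁺ (replicate⁺ (d + n ∸ suc prev) (inj₁ refl)) (inj₂ refl ∷ [])
  uppGo-steps prev (r ∷ rs) = ++⁺ (replicate⁺ (r ∸ prev) (inj₁ refl)) (inj₂ refl ∷ uppGo-steps r rs)

  upper-steps : ∀ r rs → All (λ s → s ≡ stN ⊎ s ≡ stSE) (uppSteps n d (r ∷ rs))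
  upper-steps r rs = ++⁺ (replicate⁺ (2 + r) (inj₁ refl)) (inj₂ refl ∷ uppGo-steps r rs)

-- The lower path

-- In column x the lower path of lowSteps n (s ∷ ss) runs at height countBelow (s ∷ ss) x.

module LowerPath (n : ℕ) where

  countBelow : List ℕ → ℕ → ℕ
  countBelow ss x = countᵇ (_<ᵇ x) ss

  Rising : ℕ → List ℕ → Set
  Rising s ss = Nondecreasing (s ∷ ss ++ [ n ])

  private
    row : ℕ → ℕ → List ℕ → List Step
    row k s ss = replicate k stE ++ stN ∷ lowGo n s ss

    first-step : ∀ {s t ss} → Rising s (t ∷ ss) → s ≤ t
    first-step mono = mono (s≤s (s≤s z≤n))

    ≤n : ∀ s ss → Rising s ss → s ≤ n
    ≤n s [] mono = mono (s≤s (s≤s z≤n))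
    ≤n s (t ∷ ss) mono = ≤-trans (first-step mono) (≤n t ss (mono ∘ s≤s))

    countBelow-none : ∀ s ss → Rising s ss → ∀ {x} → x ≤ s → countBelow (s ∷ ss) x ≡ 0
    countBelow-none s [] _ x≤s rewrite ≥⇒<ᵇ≡false x≤s = refl
    countBelow-none s (t ∷ ss) mono x≤s rewrite ≥⇒<ᵇ≡false x≤s = countBelow-none t ss (mono ∘ s≤s) (≤-trans x≤s (first-step mono))

    countBelow-above : ∀ s ss {x} → s < x → countBelow (s ∷ ss) x ≡ suc (countBelow ss x)
    countBelow-above s ss s<x rewrite <⇒<ᵇ≡true s<x = refl

    run-end : ∀ {s t} → s ≤ t → t ∸ s + suc s ≡ suc t
    run-end s≤t = trans (+-suc _ _) (cong suc (m∸n+n≡m s≤t))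

    run : ∀ k → replicate k stE ≡ replicate k stE ++ []
    run k = sym (++-identityʳ (replicate k stE))

    row-start : ∀ {k s x₀ y₀} → k + x₀ ≡ suc s → pt (k + x₀) y₀ ⊕ vec stN ≡ pt (suc s) (suc y₀)
    row-start {y₀ = y₀} k+x₀≡ = trans (pt⊕n _ y₀) (cong (λ x → pt x (suc y₀)) k+x₀≡)

  mutual
    ∈-row⁻ : ∀ {x₀ y₀} k s ss → k + x₀ ≡ suc s → Rising s ss → ∀ {q} → q ∈ points (pt x₀ y₀) (row k s ss) →
      ∃[ x ] ∃[ y ] q ≡ pt x y × x₀ ≤ x × x ≤ suc n × y ≤ y₀ + countBelow (s ∷ ss) x
    ∈-row⁻ {x₀} {y₀} k s ss k+x₀≡ mono {q} q∈ with ∈-points-replicate⁻ (horizontal x₀ y₀) k (stN ∷ lowGo n s ss) q∈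
    ... | inj₁ (j , j≤k , q≡) = j + x₀ , y₀ , q≡ , m≤n+m x₀ j , x≤1+n , m≤m+n y₀ _
      where
      x≤1+n : j + x₀ ≤ suc n
      x≤1+n = ≤-trans (+-monoˡ-≤ x₀ j≤k) (≤-trans (≤-reflexive k+x₀≡) (s≤s (≤n s ss mono)))
    ... | inj₂ (here q≡) = k + x₀ , y₀ , q≡ , m≤n+m x₀ k , ≤-trans (≤-reflexive k+x₀≡) (s≤s (≤n s ss mono)) , m≤m+n y₀ _
    ... | inj₂ (there q∈′)
      with ∈-lowGo⁻ s ss mono (subst (λ p → q ∈ points p (lowGo n s ss)) (row-start {k} {s} {x₀} {y₀} k+x₀≡) q∈′)
    ...   | x , y , q≡ , s<x , x≤1+n , y≤ = x , y , q≡ , ≤-trans (m≤n+m x₀ k) (≤-trans (≤-reflexive k+x₀≡) s<x) , x≤1+n ,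
            subst (y ≤_) (trans (sym (+-suc y₀ _)) (cong (y₀ +_) (sym (countBelow-above s ss s<x)))) y≤

    ∈-lowGo⁻ : ∀ {y₀} s ss → Rising s ss → ∀ {q} → q ∈ points (pt (suc s) y₀) (lowGo n s ss) →
      ∃[ x ] ∃[ y ] q ≡ pt x y × suc s ≤ x × x ≤ suc n × y ≤ y₀ + countBelow ss x
    ∈-lowGo⁻ {y₀} s [] mono {q} q∈
      with ∈-points-replicate⁻ (horizontal (suc s) y₀) (n ∸ s) [] (subst (λ ss → q ∈ points (pt (suc s) y₀) ss) (run (n ∸ s)) q∈)
    ... | inj₁ (j , j≤ , q≡) =
      j + suc s , y₀ , q≡ , m≤n+m (suc s) j , ≤-trans (+-monoˡ-≤ (suc s) j≤) (≤-reflexive (run-end (≤n s [] mono))) , m≤m+n y₀ 0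
    ... | inj₂ (here q≡) = n ∸ s + suc s , y₀ , q≡ , m≤n+m (suc s) _ , ≤-reflexive (run-end (≤n s [] mono)) , m≤m+n y₀ 0
    ∈-lowGo⁻ s (t ∷ ss) mono q∈ = ∈-row⁻ (t ∸ s) t ss (run-end (first-step mono)) (mono ∘ s≤s) q∈

  mutual
    ∈-row⁺ : ∀ {x₀ y₀} k s ss → k + x₀ ≡ suc s → Rising s ss → ∀ {x} → x₀ ≤ x → x ≤ suc n →
      pt x (y₀ + countBelow (s ∷ ss) x) ∈ points (pt x₀ y₀) (row k s ss)
    ∈-row⁺ {x₀} {y₀} k s ss k+x₀≡ mono {x} x₀≤x x≤1+n with x ≤? s
    ... | yes x≤s rewrite countBelow-none s ss mono x≤s | +-identityʳ y₀ =
      subst (λ z → pt z y₀ ∈ points (pt x₀ y₀) (row k s ss)) (m∸n+n≡m x₀≤x)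
        (∈-points-replicate⁺ (horizontal x₀ y₀) k (stN ∷ lowGo n s ss) x∸x₀≤k)
      where
      x∸x₀≤k : x ∸ x₀ ≤ k
      x∸x₀≤k = subst (x ∸ x₀ ≤_) (m+n∸n≡m k x₀) (∸-monoˡ-≤ x₀ (≤-trans (m≤n⇒m≤1+n x≤s) (≤-reflexive (sym k+x₀≡))))
    ... | no x≰s rewrite countBelow-above s ss (≰⇒> x≰s) | +-suc y₀ (countBelow ss x) =
      ∈-points-replicate⁺ʳ (horizontal x₀ y₀) k (stN ∷ lowGo n s ss)
        (there (subst (λ p → pt x (suc y₀ + countBelow ss x) ∈ points p (lowGo n s ss)) (sym (row-start {k} {s} {x₀} {y₀} k+x₀≡))
          (∈-lowGo⁺ s ss mono (≰⇒> x≰s) x≤1+n)))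

    ∈-lowGo⁺ : ∀ {y₀} s ss → Rising s ss → ∀ {x} → suc s ≤ x → x ≤ suc n →
      pt x (y₀ + countBelow ss x) ∈ points (pt (suc s) y₀) (lowGo n s ss)
    ∈-lowGo⁺ {y₀} s [] mono {x} s<x x≤1+n rewrite +-identityʳ y₀ =
      subst₂ (λ z ss → pt z y₀ ∈ points (pt (suc s) y₀) ss) (m∸n+n≡m s<x) (sym (run (n ∸ s)))
        (∈-points-replicate⁺ (horizontal (suc s) y₀) (n ∸ s) [] (∸-monoˡ-≤ (suc s) x≤1+n))
    ∈-lowGo⁺ s (t ∷ ss) mono s<x x≤1+n = ∈-row⁺ (t ∸ s) t ss (run-end (first-step mono)) (mono ∘ s≤s) s<x x≤1+n

  mutual
    endPt-row : ∀ {x₀ y₀} k s ss → k + x₀ ≡ suc s → Rising s ss →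
      endPt (pt x₀ y₀) (row k s ss) ≡ pt (suc n) (suc (length ss + y₀))
    endPt-row {x₀} {y₀} k s ss k+x₀≡ mono = begin
      endPt (pt x₀ y₀) (row k s ss)                   ≡⟨ endPt-replicate (horizontal x₀ y₀) k (stN ∷ lowGo n s ss) ⟩
      endPt (pt (k + x₀) y₀ ⊕ vec stN) (lowGo n s ss) ≡⟨ cong (λ p → endPt p (lowGo n s ss)) (row-start {k} {s} {x₀} {y₀} k+x₀≡) ⟩
      endPt (pt (suc s) (suc y₀)) (lowGo n s ss)      ≡⟨ endPt-lowGo s ss mono ⟩
      pt (suc n) (length ss + suc y₀)                 ≡⟨ cong (pt (suc n)) (+-suc (length ss) y₀) ⟩
      pt (suc n) (suc (length ss + y₀))               ∎
      where open ≡-Reasoning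

    endPt-lowGo : ∀ {y₀} s ss → Rising s ss → endPt (pt (suc s) y₀) (lowGo n s ss) ≡ pt (suc n) (length ss + y₀)
    endPt-lowGo {y₀} s [] mono =
      trans (cong (endPt (pt (suc s) y₀)) (run (n ∸ s)))
        (trans (endPt-replicate (horizontal (suc s) y₀) (n ∸ s) []) (cong (λ x → pt x y₀) (run-end (≤n s [] mono))))
    endPt-lowGo s (t ∷ ss) mono = endPt-row (t ∸ s) t ss (run-end (first-step mono)) (mono ∘ s≤s)

  mutual
    stepHeights-row : ∀ {x₀ y₀} k s ss → k + x₀ ≡ suc s → Rising s ss →
      stepHeights isE (pt x₀ y₀) (row k s ss) ≡ applyUpTo (λ i → ℤ.+ (y₀ + countBelow (s ∷ ss) (i + x₀))) (k + (n ∸ s))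
    stepHeights-row {x₀} {y₀} k s ss k+x₀≡ mono = begin
      stepHeights isE (pt x₀ y₀) (row k s ss)
        ≡⟨ stepHeights-replicate-keep refl (horizontal x₀ y₀) k (stN ∷ lowGo n s ss) ⟩
      applyUpTo (λ _ → ℤ.+ y₀) k ++ stepHeights isE (pt (k + x₀) y₀ ⊕ vec stN) (lowGo n s ss)
        ≡⟨ cong (λ p → applyUpTo (λ _ → ℤ.+ y₀) k ++ stepHeights isE p (lowGo n s ss)) (row-start {k} {s} {x₀} {y₀} k+x₀≡) ⟩
      applyUpTo (λ _ → ℤ.+ y₀) k ++ stepHeights isE (pt (suc s) (suc y₀)) (lowGo n s ss)
        ≡⟨ cong (applyUpTo (λ _ → ℤ.+ y₀) k ++_) (stepHeights-lowGo s ss mono) ⟩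
      applyUpTo (λ _ → ℤ.+ y₀) k ++ applyUpTo (λ i → ℤ.+ (suc y₀ + countBelow ss (i + suc s))) (n ∸ s)
        ≡⟨ cong₂ _++_ (applyUpTo-cong k on-run) (applyUpTo-cong (n ∸ s) (λ {i} _ → after-run i)) ⟩
      applyUpTo h k ++ applyUpTo (λ i → h (k + i)) (n ∸ s)
        ≡⟨ applyUpTo-++ h k (n ∸ s) ⟨
      applyUpTo h (k + (n ∸ s)) ∎
      where
      open ≡-Reasoning
      h : ℕ → ℤ.ℤ
      h i = ℤ.+ (y₀ + countBelow (s ∷ ss) (i + x₀))
      on-run : ∀ {i} → i < k → ℤ.+ y₀ ≡ h i
      on-run {i} i<k = cong ℤ.+_ (sym (trans (cong (y₀ +_) (countBelow-none s ss mono i+x₀≤s)) (+-identityʳ y₀)))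
        where
        i+x₀≤s : i + x₀ ≤ s
        i+x₀≤s = ≤-pred (subst (suc (i + x₀) ≤_) k+x₀≡ (+-monoˡ-≤ x₀ i<k))
      after-run : ∀ i → ℤ.+ (suc y₀ + countBelow ss (i + suc s)) ≡ h (k + i)
      after-run i = cong ℤ.+_ (begin
        suc y₀ + countBelow ss (i + suc s)          ≡⟨ +-suc y₀ _ ⟨
        y₀ + suc (countBelow ss (i + suc s))        ≡⟨ cong (y₀ +_) (countBelow-above s ss (m≤n+m (suc s) i)) ⟨
        y₀ + countBelow (s ∷ ss) (i + suc s)        ≡⟨ cong (λ x → y₀ + countBelow (s ∷ ss) x) x≡ ⟩
        y₀ + countBelow (s ∷ ss) (k + i + x₀)       ∎)
        where
        x≡ : i + suc s ≡ k + i + x₀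
        x≡ = trans (cong (i +_) (sym k+x₀≡)) (trans (sym (+-assoc i k x₀)) (cong (_+ x₀) (+-comm i k)))

    stepHeights-lowGo : ∀ {y₀} s ss → Rising s ss →
      stepHeights isE (pt (suc s) y₀) (lowGo n s ss) ≡ applyUpTo (λ i → ℤ.+ (y₀ + countBelow ss (i + suc s))) (n ∸ s)
    stepHeights-lowGo {y₀} s [] mono = begin
      stepHeights isE (pt (suc s) y₀) (replicate (n ∸ s) stE)
        ≡⟨ cong (stepHeights isE (pt (suc s) y₀)) (run (n ∸ s)) ⟩
      stepHeights isE (pt (suc s) y₀) (replicate (n ∸ s) stE ++ [])
        ≡⟨ stepHeights-replicate-keep refl (horizontal (suc s) y₀) (n ∸ s) [] ⟩
      applyUpTo (λ _ → ℤ.+ y₀) (n ∸ s) ++ []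
        ≡⟨ ++-identityʳ _ ⟩
      applyUpTo (λ _ → ℤ.+ y₀) (n ∸ s)
        ≡⟨ applyUpTo-cong (n ∸ s) (λ _ → cong ℤ.+_ (sym (+-identityʳ y₀))) ⟩
      applyUpTo (λ i → ℤ.+ (y₀ + 0)) (n ∸ s) ∎
      where open ≡-Reasoning
    stepHeights-lowGo s (t ∷ ss) mono =
      trans (stepHeights-row (t ∸ s) t ss (run-end s≤t) (mono ∘ s≤s))
        (cong (applyUpTo _) (∸-telescope s≤t (≤n t ss (mono ∘ s≤s))))
      where
      s≤t : s ≤ t
      s≤t = first-step mono

  module _ {s ss} (mono : Rising s ss) where

    private
      L : List Step
      L = lowSteps n (s ∷ ss)
      row₀ : 1 + s + 0 ≡ suc s
      row₀ = +-identityʳ (suc s)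

    ∈-lower⁻ : ∀ {q} → q ∈ points origin L → ∃[ x ] ∃[ y ] q ≡ pt x y × x ≤ suc n × y ≤ countBelow (s ∷ ss) x
    ∈-lower⁻ q∈ with ∈-row⁻ (1 + s) s ss row₀ mono q∈
    ... | x , y , q≡ , _ , x≤1+n , y≤ = x , y , q≡ , x≤1+n , y≤

    ∈-lower⁺ : ∀ {x} → x ≤ suc n → pt x (countBelow (s ∷ ss) x) ∈ points origin L
    ∈-lower⁺ = ∈-row⁺ (1 + s) s ss row₀ mono z≤n

    endPt-lower : endPt origin L ≡ pt (suc n) (suc (length ss))
    endPt-lower = trans (endPt-row (1 + s) s ss row₀ mono) (cong (pt (suc n) ∘ suc) (+-identityʳ (length ss)))

    stepHeights-lower : stepHeights isE origin L ≡ applyUpTo (λ x → ℤ.+ countBelow (s ∷ ss) x) (suc n)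
    stepHeights-lower = trans (stepHeights-row (1 + s) s ss row₀ mono)
      (trans (applyUpTo-cong (1 + s + (n ∸ s)) (λ {x} _ → cong (ℤ.+_ ∘ countBelow (s ∷ ss)) (+-identityʳ x)))
             (cong (applyUpTo (λ x → ℤ.+ countBelow (s ∷ ss) x) ∘ suc) (m+[n∸m]≡n (≤n s ss mono))))

  lowGo-steps : ∀ prev ss → All (λ s → s ≡ stE ⊎ s ≡ stN) (lowGo n prev ss)
  lowGo-steps prev [] = replicate⁺ (n ∸ prev) (inj₁ refl)
  lowGo-steps prev (s ∷ ss) = ++⁺ (replicate⁺ (s ∸ prev) (inj₁ refl)) (inj₂ refl ∷ lowGo-steps s ss)

  lower-steps : ∀ s ss → All (λ s → s ≡ stE ⊎ s ≡ stN) (lowSteps n (s ∷ ss))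
  lower-steps s ss = ++⁺ (replicate⁺ (1 + s) (inj₁ refl)) (inj₂ refl ∷ lowGo-steps s ss)

-- Recurrence

module _ {n d : ℕ} where

  cliqueIndices indepIndices : List (NSV n d) → List ℕ
  cliqueIndices [] = []
  cliqueIndices (v i ∷ us) = toℕ i ∷ cliqueIndices us
  cliqueIndices (w j ∷ us) = cliqueIndices us
  indepIndices [] = []
  indepIndices (v i ∷ us) = indepIndices us
  indepIndices (w j ∷ us) = toℕ j ∷ indepIndices us

  length-cliques+indeps : ∀ us → length us ≡ length (cliqueIndices us) + length (indepIndices us)
  length-cliques+indeps [] = refl
  length-cliques+indeps (v i ∷ us) = cong suc (length-cliques+indeps us)
  length-cliques+indeps (w j ∷ us) = trans (cong suc (length-cliques+indeps us)) (sym (+-suc _ _))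

  neighbours-w : ∀ j us → length (filterᵇ (λ u → adj u (w j)) us) ≡ length (cliqueIndices us)
  neighbours-w j [] = refl
  neighbours-w j (v i ∷ us) = cong suc (neighbours-w j us)
  neighbours-w j (w k ∷ us) = neighbours-w j us

  Unique-cliqueIndices : ∀ {us} → Unique us → Unique (cliqueIndices us)
  Unique-cliqueIndices [] = []
  Unique-cliqueIndices {v i ∷ us} (vi∉ ∷ u) = distinct vi∉ ∷ Unique-cliqueIndices u
    where
    distinct : ∀ {us} → All (v i ≢_) us → All (toℕ i ≢_) (cliqueIndices us)
    distinct {[]} [] = []
    distinct {v k ∷ us} (vi≢vk ∷ al) = (vi≢vk ∘ cong v ∘ toℕ-injective) ∷ distinct al
    distinct {w k ∷ us} (_ ∷ al) = distinct al
  Unique-cliqueIndices {w j ∷ us} (_ ∷ u) = Unique-cliqueIndices u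

  Unique-indepIndices : ∀ {us} → Unique us → Unique (indepIndices us)
  Unique-indepIndices [] = []
  Unique-indepIndices {v i ∷ us} (_ ∷ u) = Unique-indepIndices u
  Unique-indepIndices {w j ∷ us} (wj∉ ∷ u) = distinct wj∉ ∷ Unique-indepIndices u
    where
    distinct : ∀ {us} → All (w j ≢_) us → All (toℕ j ≢_) (indepIndices us)
    distinct {[]} [] = []
    distinct {v k ∷ us} (_ ∷ al) = distinct al
    distinct {w k ∷ us} (wj≢wk ∷ al) = (wj≢wk ∘ cong w ∘ toℕ-injective) ∷ distinct al

  Unique-allNS : Unique (allNS n d)
  Unique-allNS = Unique.++⁺ (Unique.map⁺ v-injective (Unique.allFin⁺ n)) (Unique.map⁺ w-injective (Unique.allFin⁺ d)) disjoint
    where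
    v-injective : ∀ {i k} → v {n} {d} i ≡ v k → i ≡ k
    v-injective refl = refl
    w-injective : ∀ {j k} → w {n} {d} j ≡ w k → j ≡ k
    w-injective refl = refl
    disjoint : ∀ {u} → u ∈ map v (allFin n) × u ∈ map w (allFin d) → ⊥
    disjoint (u∈vs , u∈ws) with ∈-map⁻ v u∈vs | ∈-map⁻ w u∈ws
    ... | _ , _ , refl | _ , _ , ()

module Split {n d : ℕ} (c : Cfg n d) where

  A B : List ℕ
  A = map (c ∘ v) (allFin n)
  B = map (c ∘ w) (allFin d)

  a b : ℕ → ℕ
  a = nth A
  b = nth B

  length-A : length A ≡ n
  length-A = length-map-allFin (c ∘ v)

  length-B : length B ≡ d
  length-B = length-map-allFin (c ∘ w)

  a-v : ∀ i → a (toℕ i) ≡ c (v i)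
  a-v = nth-map-allFin (c ∘ v)

  b-w : ∀ j → b (toℕ j) ≡ c (w j)
  b-w = nth-map-allFin (c ∘ w)

  -- Once the sink, P clique and Q independent vertices have toppled, an untoppled v k holds
  -- a k + 1 + P + Q grains and an untoppled w j holds b j + 1 + P; firedV and firedW count
  -- the unstable ones, which form an initial segment because A and B are sorted.
  firedW : ℕ → ℕ
  firedW P = countᵇ (λ t → n ≤ᵇ t + P) B

  firedV : ℕ → ℕ → ℕ
  firedV P Q = countᵇ (λ t → n + d ≤ᵇ suc (t + (P + Q))) A

  -- v P is unstable once the sink, v 0 … v (P - 1) and the independent vertices they make
  -- unstable have toppled.
  Cascade : Set
  Cascade = ∀ {P} → P < n → n + d ≤ suc (a P + (P + firedW P))

  module SortedStable (stable : Stable c) (sorted : Sorted c) where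

    nonincreasing-A : Nonincreasing A
    nonincreasing-A = map-allFin-nonincreasing (c ∘ v) (proj₁ sorted)

    nonincreasing-B : Nonincreasing B
    nonincreasing-B = map-allFin-nonincreasing (c ∘ w) (proj₂ sorted)

    a<n+d : ∀ {k} → k < n → a k < n + d
    a<n+d k<n rewrite nth-map-allFin-< (c ∘ v) k<n = stable (v (fromℕ< k<n))

    b≤n : ∀ {j} → j < d → b j ≤ n
    b≤n j<d rewrite nth-map-allFin-< (c ∘ w) j<d = ≤-pred (subst (c (w (fromℕ< j<d)) <_) (+-comm n 1) (stable (w (fromℕ< j<d))))

    -- Were v P never to become unstable, the first non-early vertex of the recurrence ordering
    -- could not topple: the early vertices toppled before it are too few.
    module Stuck {P} (P<n : P < n) (stuck : suc (a P + (P + firedW P)) < n + d) where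

      early : NSV n d → Bool
      early (v i) = toℕ i <ᵇ P
      early (w j) = n ≤ᵇ c (w j) + P

      vP : NSV n d
      vP = v (fromℕ< P<n)

      private
        Early : List (NSV n d) → Set
        Early = All (λ u → early u ≡ true)

        cliques< : ∀ {us} → Early us → All (_< P) (cliqueIndices us)
        cliques< [] = []
        cliques< {v i ∷ _} (e ∷ es) = <ᵇ≡true⇒< e ∷ cliques< es
        cliques< {w j ∷ _} (_ ∷ es) = cliques< es

        indeps< : ∀ {us} → Early us → All (_< firedW P) (indepIndices us)
        indeps< [] = []
        indeps< {v i ∷ _} (_ ∷ es) = indeps< es
        indeps< {w j ∷ _} (e ∷ es) =
          countᵇ-prefix⁻ (≤ᵇ-upwardClosed {n} (+-monoˡ-≤ P)) B nonincreasing-B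
            (subst (toℕ j <_) (sym length-B) (toℕ<n j)) (subst (λ t → (n ≤ᵇ t + P) ≡ true) (sym (b-w j)) e)
          ∷ indeps< es

        #cliques≤P : ∀ {us} → Unique us → Early us → length (cliqueIndices us) ≤ P
        #cliques≤P u es = Unique-length≤ (Unique-cliqueIndices u) (cliques< es)

        #early≤ : ∀ {us} → Unique us → Early us → length us ≤ P + firedW P
        #early≤ {us} u es = subst (_≤ P + firedW P) (sym (length-cliques+indeps us))
          (+-mono-≤ (#cliques≤P u es) (Unique-length≤ (Unique-indepIndices u) (indeps< es)))

        Received : Cfg n d → List (NSV n d) → Set
        Received cur pre = ∀ u → cur u ≤ c u + 1 + length (filterᵇ (λ x → adj x u) pre)

        received-step : ∀ {cur pre} u → Received cur pre → Received (toppleSet cur [ u ]) (pre ++ [ u ])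
        received-step {cur} {pre} u rec x = begin
          toppleSet cur [ u ] x                                         ≤⟨ m∸n≤m _ (if elemV x [ u ] then deg x else 0) ⟩
          cur x + length (filterᵇ (λ y → adj y x) [ u ])                ≤⟨ +-monoˡ-≤ _ (rec x) ⟩
          c x + 1 + length (filterᵇ (λ y → adj y x) pre) + length (filterᵇ (λ y → adj y x) [ u ])
            ≡⟨ +-assoc (c x + 1) _ _ ⟩
          c x + 1 + (length (filterᵇ (λ y → adj y x) pre) + length (filterᵇ (λ y → adj y x) [ u ]))
            ≡⟨ cong (c x + 1 +_) (length-++ (filterᵇ (λ y → adj y x) pre)) ⟨
          c x + 1 + length (filterᵇ (λ y → adj y x) pre ++ filterᵇ (λ y → adj y x) [ u ])
            ≡⟨ cong (λ us → c x + 1 + length us) (filter-++ _ pre [ u ]) ⟨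
          c x + 1 + length (filterᵇ (λ y → adj y x) (pre ++ [ u ])) ∎
          where open ≤-Reasoning

        late-stable : ∀ {cur pre} u → early u ≡ false → Unique pre → Early pre → Received cur pre → ¬ Unstable cur u
        late-stable {cur} {pre} (v i) late u es rec unstable = <⇒≱ stuck (begin
          n + d                                                       ≤⟨ unstable ⟩
          cur (v i)                                                   ≤⟨ rec (v i) ⟩
          c (v i) + 1 + length (filterᵇ (λ x → adj x (v i)) pre)      ≤⟨ +-mono-≤ (+-monoˡ-≤ 1 cvi≤aP) #neighbours ⟩
          a P + 1 + (P + firedW P)                                    ≡⟨ cong (_+ (P + firedW P)) (+-comm (a P) 1) ⟩
          suc (a P + (P + firedW P))                                  ∎)
          where
          open ≤-Reasoning
          cvi≤aP : c (v i) ≤ a P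
          cvi≤aP = subst (_≤ a P) (a-v i) (nonincreasing-A (<ᵇ≡false⇒≥ late) (subst (toℕ i <_) (sym length-A) (toℕ<n i)))
          #neighbours : length (filterᵇ (λ x → adj x (v i)) pre) ≤ P + firedW P
          #neighbours = ≤-trans (length-filterᵇ≤ (λ x → adj x (v i)) pre) (#early≤ u es)
        late-stable {cur} {pre} (w j) late u es rec unstable = <⇒≱ (+-monoˡ-< 1 (≤ᵇ≡false⇒> late)) (begin
          n + 1                                                       ≤⟨ unstable ⟩
          cur (w j)                                                   ≤⟨ rec (w j) ⟩
          c (w j) + 1 + length (filterᵇ (λ x → adj x (w j)) pre)      ≡⟨ cong (c (w j) + 1 +_) (neighbours-w j pre) ⟩
          c (w j) + 1 + length (cliqueIndices pre)                    ≤⟨ +-monoʳ-≤ (c (w j) + 1) (#cliques≤P u es) ⟩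
          c (w j) + 1 + P                                             ≡⟨ +-assoc (c (w j)) 1 P ⟩
          c (w j) + (1 + P)                                           ≡⟨ cong (c (w j) +_) (+-comm 1 P) ⟩
          c (w j) + (P + 1)                                           ≡⟨ +-assoc (c (w j)) P 1 ⟨
          c (w j) + P + 1                                             ∎)
          where open ≤-Reasoning

      walk : ∀ pre rest cur → Unique (pre ++ rest) → Early pre → Received cur pre → vP ∈ rest → ValidSeq cur rest → ⊥
      walk pre (u ∷ rest) cur uniq es rec vP∈ (unstable , valid) with early u in eu
      ... | false = late-stable {cur} {pre} u eu (Unique-++⁻ˡ pre uniq) es rec unstable
      ... | true = walk (pre ++ [ u ]) rest (toppleSet cur [ u ]) (subst Unique (sym (++-assoc pre [ u ] rest)) uniq)
                     (++⁺ es (eu ∷ [])) (received-step {cur} {pre} u rec) (vP∈rest vP∈) valid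
        where
        vP-late : early vP ≡ false
        vP-late = ≥⇒<ᵇ≡false (≤-reflexive (sym (toℕ-fromℕ< P<n)))
        vP∈rest : vP ∈ u ∷ rest → vP ∈ rest
        vP∈rest (here refl) with () ← trans (sym eu) vP-late
        vP∈rest (there vP∈) = vP∈

    recurrent⇒cascade : Recurrent c → Cascade
    recurrent⇒cascade (_ , ord , ord↭ , valid) {P} P<n with n + d ≤? suc (a P + (P + firedW P))
    ... | yes reached = reached
    ... | no stuck = ⊥-elim (walk [] ord (toppleSink c) uniq [] received vP∈ord valid)
      where
      open Stuck P<n (≰⇒> stuck)
      uniq : Unique ord
      uniq = Perm.Unique-resp-↭ (setoid (NSV n d)) (↭⇒↭ₛ (↭-sym ord↭)) Unique-allNS
      received : ∀ u → suc (c u) ≤ c u + 1 + 0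
      received u = ≤-reflexive (sym (trans (+-identityʳ (c u + 1)) (+-comm (c u) 1)))
      vP∈ord : vP ∈ ord
      vP∈ord = ∈-resp-↭ (↭-sym ord↭) (∈-++⁺ˡ (∈-map⁺ v (∈-allFin (fromℕ< P<n))))

-- CTI toppling

module _ {n d : ℕ} where

  cliqueSet : (Fin n → Bool) → List (NSV n d)
  cliqueSet R = map v (filterᵇ R (allFin n))

  indepSet : (Fin d → Bool) → List (NSV n d)
  indepSet R = map w (filterᵇ R (allFin d))

  toppleSet-cliqueSet-v : ∀ (c′ : Cfg n d) R i → toppleSet c′ (cliqueSet R) (v i) ≡
    (c′ (v i) + countᵇ (λ k → R k ∧ not (does (k Fin.≟ i))) (allFin n)) ∸ (if R i then n + d else 0)
  toppleSet-cliqueSet-v c′ R i = cong₂ (λ k b → (c′ (v i) + k) ∸ (if b then n + d else 0)) #adj member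
    where
    F : List (Fin n)
    F = filterᵇ R (allFin n)
    #adj : length (filterᵇ (λ x → adj x (v i)) (cliqueSet R)) ≡ countᵇ (λ k → R k ∧ not (does (k Fin.≟ i))) (allFin n)
    #adj = trans (length-filterᵇ (λ x → adj x (v i)) (cliqueSet R))
             (trans (countᵇ-map (λ x → adj x (v i)) v F) (countᵇ-filterᵇ (λ k → not (does (k Fin.≟ i))) R (allFin n)))
    member : elemV (v i) (cliqueSet R) ≡ R i
    member = trans (any-map (eqV (v i)) v F) (trans (any-filterᵇ (λ k → does (i Fin.≟ k)) R (allFin n)) (any-allFin-≡ R i))

  toppleSet-cliqueSet-w : ∀ (c′ : Cfg n d) R j → toppleSet c′ (cliqueSet R) (w j) ≡ c′ (w j) + countᵇ R (allFin n)
  toppleSet-cliqueSet-w c′ R j = cong₂ (λ k b → (c′ (w j) + k) ∸ (if b then n + 1 else 0)) #adj member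
    where
    F : List (Fin n)
    F = filterᵇ R (allFin n)
    #adj : length (filterᵇ (λ x → adj x (w j)) (cliqueSet R)) ≡ countᵇ R (allFin n)
    #adj = trans (length-filterᵇ (λ x → adj x (w j)) (cliqueSet R))
             (trans (countᵇ-map (λ x → adj x (w j)) v F) (trans (countᵇ-all F (λ _ → refl)) (length-filterᵇ R (allFin n))))
    member : elemV (w j) (cliqueSet R) ≡ false
    member = trans (any-map (eqV (w j)) v F) (any-none F (λ _ → refl))

  toppleSet-indepSet-v : ∀ (c′ : Cfg n d) R i → toppleSet c′ (indepSet R) (v i) ≡ c′ (v i) + countᵇ R (allFin d)
  toppleSet-indepSet-v c′ R i = cong₂ (λ k b → (c′ (v i) + k) ∸ (if b then n + d else 0)) #adj member
    where
    G : List (Fin d)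
    G = filterᵇ R (allFin d)
    #adj : length (filterᵇ (λ x → adj x (v i)) (indepSet R)) ≡ countᵇ R (allFin d)
    #adj = trans (length-filterᵇ (λ x → adj x (v i)) (indepSet R))
             (trans (countᵇ-map (λ x → adj x (v i)) w G) (trans (countᵇ-all G (λ _ → refl)) (length-filterᵇ R (allFin d))))
    member : elemV (v i) (indepSet R) ≡ false
    member = trans (any-map (eqV (v i)) w G) (any-none G (λ _ → refl))

  toppleSet-indepSet-w : ∀ (c′ : Cfg n d) R j → toppleSet c′ (indepSet R) (w j) ≡ c′ (w j) ∸ (if R j then n + 1 else 0)
  toppleSet-indepSet-w c′ R j =
    trans (cong₂ (λ k b → (c′ (w j) + k) ∸ (if b then n + 1 else 0)) #adj member) (cong (_∸ (if R j then n + 1 else 0)) (+-identityʳ (c′ (w j))))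
    where
    G : List (Fin d)
    G = filterᵇ R (allFin d)
    #adj : length (filterᵇ (λ x → adj x (w j)) (indepSet R)) ≡ 0
    #adj = trans (length-filterᵇ (λ x → adj x (w j)) (indepSet R)) (trans (countᵇ-map (λ x → adj x (w j)) w G) (countᵇ-none G (λ _ → refl)))
    member : elemV (w j) (indepSet R) ≡ R j
    member = trans (any-map (eqV (w j)) w G) (trans (any-filterᵇ (λ k → does (j Fin.≟ k)) R (allFin d)) (any-allFin-≡ R j))

reportRound : Bool → ℕ × ℕ → Maybe (List (ℕ × ℕ)) → Maybe (List (ℕ × ℕ))
reportRound done pq rest = if done then just (pq ∷ []) else Maybe.map (pq ∷_) rest

module Dynamics {n d : ℕ} (c : Cfg n d) (stable : Stable c) (sorted : Sorted c) (cascade : Split.Cascade c) where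

  open Split c
  open SortedStable stable sorted

  -- The sink, v 0 … v (P - 1) and w 0 … w (Q - 1) have toppled.
  after : ℕ → ℕ → Cfg n d
  after P Q (v i) = if toℕ i <ᵇ P then c (v i) + (P + Q) ∸ (n + d) else suc (c (v i) + (P + Q))
  after P Q (w j) = if toℕ j <ᵇ Q then c (w j) + P ∸ n else suc (c (w j) + P)

  private
    v-threshold : ∀ P Q → UpwardClosed (λ t → n + d ≤ᵇ suc (t + (P + Q)))
    v-threshold P Q = ≤ᵇ-upwardClosed {n + d} (s≤s ∘ +-monoˡ-≤ (P + Q))

    w-threshold : ∀ P → UpwardClosed (λ t → n ≤ᵇ t + P)
    w-threshold P = ≤ᵇ-upwardClosed {n} (+-monoˡ-≤ P)

    k<|A| : ∀ {k} → k < n → k < length A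
    k<|A| = subst (_ <_) (sym length-A)

    j<|B| : ∀ {j} → j < d → j < length B
    j<|B| = subst (_ <_) (sym length-B)

  fired-v : ∀ P Q {k} → k < n → (n + d ≤ᵇ suc (a k + (P + Q))) ≡ (k <ᵇ firedV P Q)
  fired-v P Q k<n = countᵇ-prefix (v-threshold P Q) A nonincreasing-A (k<|A| k<n)

  fired-v⁺ : ∀ P Q {k} → k < firedV P Q → n + d ≤ suc (a k + (P + Q))
  fired-v⁺ P Q k< = ≤ᵇ≡true⇒≤ (countᵇ-prefix⁺ (v-threshold P Q) A nonincreasing-A k<)

  fired-v⁻ : ∀ P Q {k} → k < n → n + d ≤ suc (a k + (P + Q)) → k < firedV P Q
  fired-v⁻ P Q k<n le = countᵇ-prefix⁻ (v-threshold P Q) A nonincreasing-A (k<|A| k<n) (≤⇒≤ᵇ≡true le)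

  fired-w : ∀ P {j} → j < d → (n ≤ᵇ b j + P) ≡ (j <ᵇ firedW P)
  fired-w P j<d = countᵇ-prefix (w-threshold P) B nonincreasing-B (j<|B| j<d)

  fired-w⁺ : ∀ P {j} → j < firedW P → n ≤ b j + P
  fired-w⁺ P j< = ≤ᵇ≡true⇒≤ (countᵇ-prefix⁺ (w-threshold P) B nonincreasing-B j<)

  firedV≤n : ∀ P Q → firedV P Q ≤ n
  firedV≤n P Q = subst (firedV P Q ≤_) length-A (countᵇ≤length _ A)

  firedW≤d : ∀ P → firedW P ≤ d
  firedW≤d P = subst (firedW P ≤_) length-B (countᵇ≤length _ B)

  firedW-mono : ∀ {P P′} → P ≤ P′ → firedW P ≤ firedW P′
  firedW-mono P≤P′ = countᵇ-mono B (λ t e → ≤⇒≤ᵇ≡true (≤-trans (≤ᵇ≡true⇒≤ {n} e) (+-monoʳ-≤ t P≤P′)))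

  firedW-n : firedW n ≡ d
  firedW-n = trans (countᵇ-all B (λ t → ≤⇒≤ᵇ≡true (m≤n+m n t))) length-B

  record Reached (P Q : ℕ) : Set where
    field
      P≤n : P ≤ n
      Q≤firedW : Q ≤ firedW P
      toppled : ∀ {k} → k < P → n + d ≤ a k + (P + Q)

  open Reached public

  reached-start : Reached 0 0
  reached-start = record { P≤n = z≤n ; Q≤firedW = z≤n ; toppled = λ () }

  P≤firedV : ∀ {P Q} → Reached P Q → P ≤ firedV P Q
  P≤firedV {zero} r = z≤n
  P≤firedV {suc P} {Q} r = fired-v⁻ (suc P) Q (P≤n r) (m≤n⇒m≤1+n (toppled r ≤-refl))

  toppled-next : ∀ {P Q} → Reached P Q → ∀ {k} → k < firedV P Q → n + d ≤ a k + (firedV P Q + Q)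
  toppled-next {P} {Q} r {k} k< with k <? P
  ... | yes k<P = ≤-trans (toppled r k<P) (+-monoʳ-≤ (a k) (+-monoˡ-≤ Q (P≤firedV r)))
  ... | no k≮P = ≤-trans (fired-v⁺ P Q k<) (≤-trans (≤-reflexive (sym (+-suc (a k) (P + Q))))
                   (+-monoʳ-≤ (a k) (+-monoˡ-≤ Q (<-≤-trans (≰⇒> k≮P) k<))))

  reached-cliques : ∀ {P Q} → Reached P Q → Reached (firedV P Q) Q
  reached-cliques {P} {Q} r = record
    { P≤n = firedV≤n P Q
    ; Q≤firedW = ≤-trans (Q≤firedW r) (firedW-mono (P≤firedV r))
    ; toppled = toppled-next r
    }

  reached-indeps : ∀ {P Q} → Reached P Q → Reached P (firedW P)
  reached-indeps {P} {Q} r = record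
    { P≤n = P≤n r
    ; Q≤firedW = ≤-refl
    ; toppled = λ {k} k<P → ≤-trans (toppled r k<P) (+-monoʳ-≤ (a k) (+-monoʳ-≤ P (Q≤firedW r)))
    }

  reached-next : ∀ {P Q} → Reached P Q → Reached (firedV P Q) (firedW (firedV P Q))
  reached-next = reached-indeps ∘ reached-cliques

  progress : ∀ {P} → P < n → P < firedV P (firedW P)
  progress {P} P<n = fired-v⁻ P (firedW P) P<n (cascade P<n)

  round : ℕ → ℕ → ℕ × ℕ
  round P Q = (firedV P Q ∸ P , firedW (firedV P Q) ∸ Q)

  rounds : ℕ → ℕ → ℕ → List (ℕ × ℕ)
  rounds zero P Q = []
  rounds (suc k) P Q = round P Q ∷ (if n ≤ᵇ firedV P Q then [] else rounds k (firedV P Q) (firedW (firedV P Q)))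

  private
    [x+y]∸m≤x : ∀ x {y m} → y ≤ m → x + y ∸ m ≤ x
    [x+y]∸m≤x x {y} {m} y≤m = ≤-trans (∸-monoʳ-≤ (x + y) y≤m) (≤-reflexive (m+n∸n≡m x y))

    P+Q≤n+d : ∀ {P Q} → Reached P Q → P + Q ≤ n + d
    P+Q≤n+d {P} r = +-mono-≤ (P≤n r) (≤-trans (Q≤firedW r) (firedW≤d P))

    suc≤ᵇsuc : ∀ m k → (suc m ≤ᵇ suc k) ≡ (m ≤ᵇ k)
    suc≤ᵇsuc zero k = refl
    suc≤ᵇsuc (suc m) k = refl

  unstable-v : ∀ {P Q} → Reached P Q → ∀ i → unstableᵇ (after P Q) (v i) ≡ inRange P (firedV P Q) (toℕ i)
  unstable-v {P} {Q} r i with toℕ i <ᵇ P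
  ... | true = >⇒≤ᵇ≡false (≤-<-trans ([x+y]∸m≤x (c (v i)) (P+Q≤n+d r)) (stable (v i)))
  ... | false = trans (cong (λ x → n + d ≤ᵇ suc (x + (P + Q))) (sym (a-v i))) (fired-v P Q (toℕ<n i))

  unstable-w : ∀ {P Q} → P ≤ n → ∀ j → unstableᵇ (after P Q) (w j) ≡ inRange Q (firedW P) (toℕ j)
  unstable-w {P} {Q} P≤n′ j with toℕ j <ᵇ Q
  ... | true = >⇒≤ᵇ≡false (≤-<-trans ([x+y]∸m≤x (c (w j)) P≤n′) (stable (w j)))
  ... | false = begin
    n + 1 ≤ᵇ suc (c (w j) + P)   ≡⟨ cong (_≤ᵇ suc (c (w j) + P)) (+-comm n 1) ⟩
    suc n ≤ᵇ suc (c (w j) + P)   ≡⟨ suc≤ᵇsuc n (c (w j) + P) ⟩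
    n ≤ᵇ c (w j) + P             ≡⟨ cong (λ x → n ≤ᵇ x + P) (b-w j) ⟨
    n ≤ᵇ b (toℕ j) + P           ≡⟨ fired-w P (toℕ<n j) ⟩
    toℕ j <ᵇ firedW P            ∎
    where open ≡-Reasoning

  unstableCliques unstableIndeps : Cfg n d → List (NSV n d)
  unstableCliques c′ = filterᵇ (λ u → isClique u ∧ unstableᵇ c′ u) (allNS n d)
  unstableIndeps c′ = filterᵇ (λ u → isIndep u ∧ unstableᵇ c′ u) (allNS n d)

  private
    filterᵇ-allNS : ∀ (p : NSV n d → Bool) →
      filterᵇ p (allNS n d) ≡ map v (filterᵇ (p ∘ v) (allFin n)) ++ map w (filterᵇ (p ∘ w) (allFin d))
    filterᵇ-allNS p = trans (filter-++ (T? ∘ p) (map v (allFin n)) (map w (allFin d)))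
      (cong₂ _++_ (filterᵇ-map p v (allFin n)) (filterᵇ-map p w (allFin d)))

  unstableCliques-after : ∀ {P Q c′} → Reached P Q → c′ ≗ after P Q →
    unstableCliques c′ ≡ cliqueSet (inRange P (firedV P Q) ∘ toℕ)
  unstableCliques-after {P} {Q} {c′} r c′≗ = begin
    unstableCliques c′
      ≡⟨ filterᵇ-allNS (λ u → isClique u ∧ unstableᵇ c′ u) ⟩
    map v (filterᵇ (λ i → unstableᵇ c′ (v i)) (allFin n)) ++ map w (filterᵇ (λ _ → false) (allFin d))
      ≡⟨ cong₂ _++_ (cong (map v) (filterᵇ-cong (allFin n) (λ i → trans (cong (n + d ≤ᵇ_) (c′≗ (v i))) (unstable-v r i))))
                    (cong (map w) (filterᵇ-none (allFin d) (λ _ → refl))) ⟩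
    cliqueSet (inRange P (firedV P Q) ∘ toℕ) ++ []
      ≡⟨ ++-identityʳ _ ⟩
    cliqueSet (inRange P (firedV P Q) ∘ toℕ) ∎
    where open ≡-Reasoning

  unstableIndeps-after : ∀ {P Q c′} → P ≤ n → c′ ≗ after P Q → unstableIndeps c′ ≡ indepSet (inRange Q (firedW P) ∘ toℕ)
  unstableIndeps-after {P} {Q} {c′} P≤n′ c′≗ = begin
    unstableIndeps c′
      ≡⟨ filterᵇ-allNS (λ u → isIndep u ∧ unstableᵇ c′ u) ⟩
    map v (filterᵇ (λ _ → false) (allFin n)) ++ map w (filterᵇ (λ j → unstableᵇ c′ (w j)) (allFin d))
      ≡⟨ cong₂ _++_ (cong (map v) (filterᵇ-none (allFin n) (λ _ → refl)))
                    (cong (map w) (filterᵇ-cong (allFin d) (λ j → trans (cong (n + 1 ≤ᵇ_) (c′≗ (w j))) (unstable-w {Q = Q} P≤n′ j)))) ⟩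
    indepSet (inRange Q (firedW P) ∘ toℕ) ∎
    where open ≡-Reasoning

  private
    slide : ∀ x {P P′} Q → P ≤ P′ → x + (P + Q) + (P′ ∸ P) ≡ x + (P′ + Q)
    slide x Q P≤P′ = trans (+-assoc x _ _) (cong (x +_) ([a+m]+[b∸a]≡b+m Q P≤P′))

    slideʳ : ∀ x P {Q Q′} → Q ≤ Q′ → x + (P + Q) + (Q′ ∸ Q) ≡ x + (P + Q′)
    slideʳ x P Q≤Q′ = trans (+-assoc x _ _) (cong (x +_) ([m+a]+[b∸a]≡m+b P Q≤Q′))

    cliques-v : ∀ {P Q} → Reached P Q → ∀ i K → K + boolToℕ (inRange P (firedV P Q) (toℕ i)) ≡ firedV P Q ∸ P →
      (after P Q (v i) + K) ∸ (if inRange P (firedV P Q) (toℕ i) then n + d else 0) ≡ after (firedV P Q) Q (v i)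
    cliques-v {P} {Q} r i K K≡ with toℕ i <? P
    ... | yes i<P rewrite <⇒<ᵇ≡true i<P | <⇒<ᵇ≡true (<-≤-trans i<P (P≤firedV r)) = begin
      c (v i) + (P + Q) ∸ (n + d) + K        ≡⟨ +-∸-comm K toppled-enough ⟨
      c (v i) + (P + Q) + K ∸ (n + d)        ≡⟨ cong (λ k → c (v i) + (P + Q) + k ∸ (n + d)) (trans (sym (+-identityʳ K)) K≡) ⟩
      c (v i) + (P + Q) + (firedV P Q ∸ P) ∸ (n + d) ≡⟨ cong (_∸ (n + d)) (slide (c (v i)) Q (P≤firedV r)) ⟩
      c (v i) + (firedV P Q + Q) ∸ (n + d)   ∎
      where
      open ≡-Reasoning
      toppled-enough : n + d ≤ c (v i) + (P + Q)
      toppled-enough = subst (λ x → n + d ≤ x + (P + Q)) (a-v i) (toppled r i<P)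
    ... | no i≮P rewrite ≥⇒<ᵇ≡false (≮⇒≥ i≮P) with toℕ i <? firedV P Q
    ...   | yes i<P′ rewrite <⇒<ᵇ≡true i<P′ = cong (_∸ (n + d)) (begin
      suc (c (v i) + (P + Q) + K)            ≡⟨ +-suc (c (v i) + (P + Q)) K ⟨
      c (v i) + (P + Q) + suc K              ≡⟨ cong (c (v i) + (P + Q) +_) (trans (+-comm 1 K) K≡) ⟩
      c (v i) + (P + Q) + (firedV P Q ∸ P)   ≡⟨ slide (c (v i)) Q (P≤firedV r) ⟩
      c (v i) + (firedV P Q + Q)             ∎)
      where open ≡-Reasoning
    ...   | no i≮P′ rewrite ≥⇒<ᵇ≡false (≮⇒≥ i≮P′) =
      cong suc (trans (cong (c (v i) + (P + Q) +_) (trans (sym (+-identityʳ K)) K≡)) (slide (c (v i)) Q (P≤firedV r)))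

    cliques-w : ∀ {P Q} → Reached P Q → ∀ j → after P Q (w j) + (firedV P Q ∸ P) ≡ after (firedV P Q) Q (w j)
    cliques-w {P} {Q} r j with toℕ j <ᵇ Q in j<Q
    ... | true = begin
      c (w j) + P ∸ n + (firedV P Q ∸ P)     ≡⟨ +-∸-comm (firedV P Q ∸ P) toppled-enough ⟨
      c (w j) + P + (firedV P Q ∸ P) ∸ n     ≡⟨ cong (_∸ n) ([m+a]+[b∸a]≡m+b (c (w j)) (P≤firedV r)) ⟩
      c (w j) + firedV P Q ∸ n               ∎
      where
      open ≡-Reasoning
      toppled-enough : n ≤ c (w j) + P
      toppled-enough = subst (λ x → n ≤ x + P) (b-w j) (fired-w⁺ P (<-≤-trans (<ᵇ≡true⇒< j<Q) (Q≤firedW r)))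
    ... | false = cong suc ([m+a]+[b∸a]≡m+b (c (w j)) (P≤firedV r))

    indeps-v : ∀ {P Q} → Reached P Q → ∀ i → after P Q (v i) + (firedW P ∸ Q) ≡ after P (firedW P) (v i)
    indeps-v {P} {Q} r i with toℕ i <ᵇ P in i<P
    ... | true = trans (sym (+-∸-comm (firedW P ∸ Q) toppled-enough)) (cong (_∸ (n + d)) (slideʳ (c (v i)) P (Q≤firedW r)))
      where
      toppled-enough : n + d ≤ c (v i) + (P + Q)
      toppled-enough = subst (λ x → n + d ≤ x + (P + Q)) (a-v i) (toppled r (<ᵇ≡true⇒< i<P))
    ... | false = cong suc (slideʳ (c (v i)) P (Q≤firedW r))

    indeps-w : ∀ {P Q} → Reached P Q → ∀ j →
      after P Q (w j) ∸ (if inRange Q (firedW P) (toℕ j) then n + 1 else 0) ≡ after P (firedW P) (w j)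
    indeps-w {P} {Q} r j with toℕ j <? Q
    ... | yes j<Q rewrite <⇒<ᵇ≡true j<Q | <⇒<ᵇ≡true (<-≤-trans j<Q (Q≤firedW r)) = refl
    ... | no j≮Q rewrite ≥⇒<ᵇ≡false (≮⇒≥ j≮Q) with toℕ j <? firedW P
    ...   | yes j<Q′ rewrite <⇒<ᵇ≡true j<Q′ = cong (suc (c (w j) + P) ∸_) (+-comm n 1)
    ...   | no j≮Q′ rewrite ≥⇒<ᵇ≡false (≮⇒≥ j≮Q′) = refl

  topple-cliques : ∀ {P Q c′} → Reached P Q → c′ ≗ after P Q →
    toppleSet c′ (cliqueSet (inRange P (firedV P Q) ∘ toℕ)) ≗ after (firedV P Q) Q
  topple-cliques {P} {Q} {c′} r c′≗ (v i) =
    trans (toppleSet-cliqueSet-v c′ R i)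
      (trans (cong (λ x → (x + K) ∸ (if R i then n + d else 0)) (c′≗ (v i)))
        (cliques-v r i K (trans (countᵇ-allFin-≢ R i) (countᵇ-inRange (P≤firedV r) (firedV≤n P Q)))))
    where
    R : Fin n → Bool
    R = inRange P (firedV P Q) ∘ toℕ
    K : ℕ
    K = countᵇ (λ k → R k ∧ not (does (k Fin.≟ i))) (allFin n)
  topple-cliques {P} {Q} {c′} r c′≗ (w j) =
    trans (toppleSet-cliqueSet-w c′ R j)
      (trans (cong₂ _+_ (c′≗ (w j)) (countᵇ-inRange (P≤firedV r) (firedV≤n P Q))) (cliques-w r j))
    where
    R : Fin n → Bool
    R = inRange P (firedV P Q) ∘ toℕ

  topple-indeps : ∀ {P Q c′} → Reached P Q → c′ ≗ after P Q →
    toppleSet c′ (indepSet (inRange Q (firedW P) ∘ toℕ)) ≗ after P (firedW P)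
  topple-indeps {P} {Q} {c′} r c′≗ (v i) =
    trans (toppleSet-indepSet-v c′ R i)
      (trans (cong₂ _+_ (c′≗ (v i)) (countᵇ-inRange (Q≤firedW r) (firedW≤d P))) (indeps-v r i))
    where
    R : Fin d → Bool
    R = inRange Q (firedW P) ∘ toℕ
  topple-indeps {P} {Q} {c′} r c′≗ (w j) =
    trans (toppleSet-indepSet-w c′ R j) (trans (cong (_∸ (if R j then n + 1 else 0)) (c′≗ (w j))) (indeps-w r j))
    where
    R : Fin d → Bool
    R = inRange Q (firedW P) ∘ toℕ

  stableᵇ-after : ∀ {P} → P ≤ n → stableᵇ (after P (firedW P)) ≡ (n ≤ᵇ P)
  stableᵇ-after {P} P≤n′ with m≤n⇒m<n∨m≡n P≤n′
  ... | inj₁ P<n = trans (all-false (∈-++⁺ˡ (∈-map⁺ v (∈-allFin (fromℕ< P<n)))) vP-unstable) (sym (>⇒≤ᵇ≡false P<n))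
    where
    vP-unstable : (after P (firedW P) (v (fromℕ< P<n)) <ᵇ n + d) ≡ false
    vP-unstable rewrite toℕ-fromℕ< P<n | ≥⇒<ᵇ≡false (≤-refl {P}) | sym (nth-map-allFin-< (c ∘ v) P<n) =
      ≥⇒<ᵇ≡false (cascade P<n)
  ... | inj₂ refl = trans (all-true (allNS n d) settled) (sym (≤⇒≤ᵇ≡true (≤-refl {n})))
    where
    settled : ∀ u → (after n (firedW n) u <ᵇ deg u) ≡ true
    settled (v i) rewrite <⇒<ᵇ≡true (toℕ<n i) | firedW-n | m+n∸n≡m (c (v i)) (n + d) = <⇒<ᵇ≡true (stable (v i))
    settled (w j) rewrite firedW-n | <⇒<ᵇ≡true (toℕ<n j) | m+n∸n≡m (c (w j)) n = <⇒<ᵇ≡true (stable (w j))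

  stableᵇ-cong : ∀ {c₁ c₂ : Cfg n d} → c₁ ≗ c₂ → stableᵇ c₁ ≡ stableᵇ c₂
  stableᵇ-cong c₁≗c₂ = all-cong (allNS n d) (λ u → cong (_<ᵇ deg u) (c₁≗c₂ u))

  cti-step : ∀ {P Q c′} → Reached P Q → c′ ≗ after P Q →
    ∃[ c″ ] c″ ≗ after (firedV P Q) (firedW (firedV P Q)) ×
      (∀ k → ctiLoop (suc k) c′ ≡ reportRound (n ≤ᵇ firedV P Q) (round P Q) (ctiLoop k c″))
  cti-step {P} {Q} {c′} r c′≗ = c₂ , c₂≗ , λ k → cong₂ (λ b pq → reportRound b pq (ctiLoop k c₂))
    (trans (stableᵇ-cong c₂≗) (stableᵇ-after (P≤n r′))) (cong₂ _,_ #cliques #indeps)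
    where
    r′ : Reached (firedV P Q) Q
    r′ = reached-cliques r
    P′ : ℕ
    P′ = firedV P Q
    c₁ : Cfg n d
    c₁ = toppleSet c′ (unstableCliques c′)
    c₂ : Cfg n d
    c₂ = toppleSet c₁ (unstableIndeps c₁)
    c₁≗ : c₁ ≗ after P′ Q
    c₁≗ u = trans (cong (λ S → toppleSet c′ S u) (unstableCliques-after r c′≗)) (topple-cliques r c′≗ u)
    c₂≗ : c₂ ≗ after P′ (firedW P′)
    c₂≗ u = trans (cong (λ S → toppleSet c₁ S u) (unstableIndeps-after (P≤n r′) c₁≗)) (topple-indeps r′ c₁≗ u)
    #cliques : length (unstableCliques c′) ≡ P′ ∸ P
    #cliques = trans (cong length (unstableCliques-after r c′≗))
      (trans (length-map v (filterᵇ (inRange P P′ ∘ toℕ) (allFin n)))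
        (trans (length-filterᵇ (inRange P P′ ∘ toℕ) (allFin n)) (countᵇ-inRange (P≤firedV r) (firedV≤n P Q))))
    #indeps : length (unstableIndeps c₁) ≡ firedW P′ ∸ Q
    #indeps = trans (cong length (unstableIndeps-after (P≤n r′) c₁≗))
      (trans (length-map w (filterᵇ (inRange Q (firedW P′) ∘ toℕ) (allFin d)))
        (trans (length-filterᵇ (inRange Q (firedW P′) ∘ toℕ) (allFin d)) (countᵇ-inRange (Q≤firedW r′) (firedW≤d P′))))

  module Iterate (Yields : ℕ → ℕ → List (ℕ × ℕ) → Set)
    (last : ∀ {P Q} → Reached P Q → n ≤ firedV P Q → Yields P Q (round P Q ∷ []))
    (more : ∀ {P Q T} → Reached P Q → firedV P Q < n → Yields (firedV P Q) (firedW (firedV P Q)) T → Yields P Q (round P Q ∷ T))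
    where

    yields-rounds : ∀ k {P Q} → Reached P Q → n ∸ firedV P Q ≤ k → Yields P Q (rounds (suc k) P Q)
    yields-rounds k {P} {Q} r enough with n ≤? firedV P Q
    ... | yes done rewrite ≤⇒≤ᵇ≡true done = last r done
    ... | no not-done rewrite >⇒≤ᵇ≡false (≰⇒> not-done) with k
    ...   | zero = ⊥-elim (not-done (m∸n≡0⇒m≤n (n≤0⇒n≡0 enough)))
    ...   | suc k′ = more r (≰⇒> not-done) (yields-rounds k′ (reached-next r) (≤-pred (≤-trans shrinks enough)))
      where
      P′ : ℕ
      P′ = firedV P Q
      shrinks : n ∸ firedV P′ (firedW P′) < n ∸ P′
      shrinks = ∸-monoʳ-< (progress (≰⇒> not-done)) (firedV≤n P′ (firedW P′))

    yields : Yields 0 0 (rounds (suc n) 0 0)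
    yields = yields-rounds n reached-start (m∸n≤m n (firedV 0 0))

  ToppleCTIFrom : ℕ → ℕ → List (ℕ × ℕ) → Set
  ToppleCTIFrom P Q T = ∀ {c′} → c′ ≗ after P Q → ∃[ fuel ] ctiLoop fuel c′ ≡ just T

  toppleCTI : ToppleCTI c (rounds (suc n) 0 0)
  toppleCTI = Iterate.yields ToppleCTIFrom last more sink≗
    where
    last : ∀ {P Q} → Reached P Q → n ≤ firedV P Q → ToppleCTIFrom P Q (round P Q ∷ [])
    last {P} {Q} r done c′≗ with cti-step r c′≗
    ... | c″ , _ , loop = 1 , trans (loop 0) (cong (λ b → reportRound b (round P Q) (ctiLoop 0 c″)) (≤⇒≤ᵇ≡true done))
    more : ∀ {P Q T} → Reached P Q → firedV P Q < n → ToppleCTIFrom (firedV P Q) (firedW (firedV P Q)) T → ToppleCTIFrom P Q (round P Q ∷ T)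
    more {P} {Q} r not-done rest c′≗ with cti-step r c′≗
    ... | c″ , c″≗ , loop with rest c″≗
    ...   | fuel , ends = suc fuel , trans (loop fuel)
      (trans (cong (λ b → reportRound b (round P Q) (ctiLoop fuel c″)) (>⇒≤ᵇ≡false not-done)) (cong (Maybe.map (round P Q ∷_)) ends))
    sink≗ : toppleSink c ≗ after 0 0
    sink≗ (v i) = cong suc (sym (+-identityʳ (c (v i))))
    sink≗ (w j) = cong suc (sym (+-identityʳ (c (w j))))

-- The bounce path

isOrigin : Point → Bool
isOrigin p = does (≡-dec ℤ._≟_ ℤ._≟_ p origin)

module _ (Up Lp : List Point) where

  nw-run : ∀ i {x y k m F} →
    (∀ {X Y} → x < X → X ≤ i + x → X + Y ≡ i + x + y → elemP (pt X Y) Up ≡ false) → elemP (pt x (i + y)) Up ≡ true →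
    bounceLoop (i + suc F) Up Lp goNW (pt (i + x) y) k m ≡ bounceLoop F Up Lp goS (pt x (i + y)) (k + i) 0
  nw-run zero {k = k} _ on-upper rewrite on-upper | +-identityʳ k = refl
  nw-run (suc i) {x} {y} {k} {F = F} off-upper on-upper
    rewrite off-upper {suc i + x} {y} (s≤s (m≤n+m x i)) ≤-refl refl | pt⊕nw (i + x) y | +-suc k i =
    subst (λ z → bounceLoop (i + suc F) Up Lp goNW (pt (i + x) (suc y)) (suc k) 0 ≡ bounceLoop F Up Lp goS (pt x z) (suc (k + i)) 0)
      (+-suc i y)
      (nw-run i (λ x<X X≤ X+Y≡ → off-upper x<X (m≤n⇒m≤1+n X≤) (trans X+Y≡ (+-suc (i + x) y))) (subst (λ z → elemP (pt x z) Up ≡ true) (sym (+-suc i y)) on-upper))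

  s-run : ∀ i {x y k m F} →
    (∀ {Y} → y < Y → Y ≤ i + y → elemP (pt x Y) Lp ≡ false) → elemP (pt x y) Lp ≡ true →
    bounceLoop (i + suc F) Up Lp goS (pt x (i + y)) k m ≡
      reportRound (isOrigin (pt x y)) (k , m + i) (bounceLoop F Up Lp goNW (pt x y) 0 0)
  s-run zero {m = m} _ on-lower rewrite on-lower | +-identityʳ m = refl
  s-run (suc i) {x} {y} {k} {m} off-lower on-lower
    rewrite off-lower {suc i + y} (s≤s (m≤n+m y i)) ≤-refl | pt⊕s x (i + y) | +-suc m i =
    s-run i (λ y<Y Y≤ → off-lower y<Y (m≤n⇒m≤1+n Y≤)) on-lower

∑ : ℕ → (ℕ → ℕ) → ℕ
∑ m f = sum (applyUpTo f m)

∑-+ : ∀ m (f g : ℕ → ℕ) → ∑ m (λ x → f x + g x) ≡ ∑ m f + ∑ m g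
∑-+ zero f g = refl
∑-+ (suc m) f g = trans (cong (f 0 + g 0 +_) (∑-+ m (f ∘ suc) (g ∘ suc))) (interchange (f 0) (g 0) (∑ m (f ∘ suc)) (∑ m (g ∘ suc)))

∑-cong : ∀ m {f g : ℕ → ℕ} → (∀ {x} → x < m → f x ≡ g x) → ∑ m f ≡ ∑ m g
∑-cong m f≗g = cong sum (applyUpTo-cong m f≗g)

∑-const : ∀ m k → ∑ m (λ _ → k) ≡ m * k
∑-const zero k = refl
∑-const (suc m) k = cong (k +_) (∑-const m k)

∑-suc : ∀ m f → ∑ (suc m) f ≡ ∑ m f + f m
∑-suc m f = trans (cong sum (sym (applyUpTo-∷ʳ f m))) (trans (sum-++ (applyUpTo f m) [ f m ]) (cong (∑ m f +_) (+-identityʳ (f m))))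

∑-nth : ∀ xs → ∑ (length xs) (nth xs) ≡ sum xs
∑-nth [] = refl
∑-nth (x ∷ xs) = cong (x +_) (∑-nth xs)

[1+m]C2 : ∀ m → suc m C 2 ≡ m C 2 + m
[1+m]C2 m = trans (sym (nCk+nC[k+1]≡[n+1]C[k+1] m 1)) (trans (cong (_+ m C 2) (nC1≡n m)) (+-comm m (m C 2)))

∑-id : ∀ m → ∑ m id ≡ m C 2
∑-id zero = refl
∑-id (suc m) = trans (∑-suc m id) (trans (cong (_+ m) (∑-id m)) (sym ([1+m]C2 m)))

[m+n]C2 : ∀ m n → (m + n) C 2 ≡ m C 2 + n C 2 + m * n
[m+n]C2 m zero = trans (cong (_C 2) (+-identityʳ m))
  (sym (trans (cong (m C 2 + 0 +_) (*-zeroʳ m)) (trans (+-identityʳ (m C 2 + 0)) (+-identityʳ (m C 2)))))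
[m+n]C2 m (suc n) rewrite +-suc m n | [1+m]C2 (m + n) | [m+n]C2 m n | [1+m]C2 n | *-suc m n = lemma (m C 2) (n C 2) (m * n) m n
  where
  lemma : ∀ a b c m n → a + b + c + (m + n) ≡ a + (b + n) + (m + c)
  lemma = solve-∀

-- Double counting: the entry t lies below the columns t + 1 … n.
∑-countBelow : ∀ n xs → All (_≤ n) xs → ∑ (suc n) (λ x → countᵇ (_<ᵇ x) xs) + sum xs ≡ n * length xs
∑-countBelow n [] [] = trans (+-identityʳ _) (trans (∑-const (suc n) 0) (trans (*-zeroʳ (suc n)) (sym (*-zeroʳ n))))
∑-countBelow n (t ∷ xs) (t≤n ∷ xs≤n) = begin
  ∑ (suc n) (λ x → countᵇ (_<ᵇ x) (t ∷ xs)) + (t + sum xs)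
    ≡⟨ cong (_+ (t + sum xs)) (trans (∑-cong (suc n) (λ {x} _ → countᵇ-∷ (_<ᵇ x) t xs)) (∑-+ (suc n) (λ x → boolToℕ (t <ᵇ x)) (λ x → countᵇ (_<ᵇ x) xs))) ⟩
  ∑ (suc n) (λ x → boolToℕ (t <ᵇ x)) + ∑ (suc n) (λ x → countᵇ (_<ᵇ x) xs) + (t + sum xs)
    ≡⟨ interchange (∑ (suc n) (λ x → boolToℕ (t <ᵇ x))) (∑ (suc n) (λ x → countᵇ (_<ᵇ x) xs)) t (sum xs) ⟩
  (∑ (suc n) (λ x → boolToℕ (t <ᵇ x)) + t) + (∑ (suc n) (λ x → countᵇ (_<ᵇ x) xs) + sum xs)
    ≡⟨ cong₂ _+_ (columns-right-of t≤n) (∑-countBelow n xs xs≤n) ⟩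
  n + n * length xs
    ≡⟨ *-suc n (length xs) ⟨
  n * length (t ∷ xs) ∎
  where
  open ≡-Reasoning
  columns-right-of : ∀ {t n} → t ≤ n → ∑ (suc n) (λ x → boolToℕ (t <ᵇ x)) + t ≡ n
  columns-right-of {zero} {n} _ = trans (+-identityʳ _) (trans (∑-const n 1) (*-identityʳ n))
  columns-right-of {suc t} {suc n} (s≤s t≤n) = trans (+-suc _ t) (cong suc (columns-right-of t≤n))

column-area : ∀ m k → ℤ.∣ (ℤ.+ suc m ℤ.- ℤ.1ℤ ℤ.- ℤ.+ k) ℤ.⊔ ℤ.+ 0 ∣ ≡ m ∸ k
column-area m k rewrite ℤ.[+m]-[+n]≡m⊖n m k with k ≤? m
... | yes k≤m rewrite ℤ.⊖-≥ k≤m = ⊔-identityʳ (m ∸ k)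
... | no k≰m rewrite ℤ.⊖-< (≰⇒> k≰m) | m≤n⇒m∸n≡0 (<⇒≤ (≰⇒> k≰m)) with k ∸ m | m<n⇒0<n∸m (≰⇒> k≰m)
...   | suc _ | _ = refl

-- The paths of f c

module ImagePaths {n d : ℕ} (c : Cfg n d) (stable : Stable c) (sorted : Sorted c) (cascade : Split.Cascade c)
              (1≤d : 1 ≤ d) {r rs s ss} (reverse-A : reverse (Split.A c) ≡ r ∷ rs) (reverse-B : reverse (Split.B c) ≡ s ∷ ss) where

  open Split c
  open SortedStable stable sorted
  open Dynamics c stable sorted cascade

  top : ℕ
  top = d + n ∸ 1

  d+n≡1+top : d + n ≡ suc top
  d+n≡1+top = sym (m+[n∸m]≡n (≤-trans 1≤d (m≤m+n d n)))

  open UpperPath n d top d+n≡1+top public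
  open LowerPath n public

  U L : List Step
  U = uppSteps n d (r ∷ rs)
  L = lowSteps n (s ∷ ss)

  1+|rs|≡n : suc (length rs) ≡ n
  1+|rs|≡n = trans (cong length (sym reverse-A)) (trans (length-reverse A) length-A)

  1+|ss|≡d : suc (length ss) ≡ d
  1+|ss|≡d = trans (cong length (sym reverse-B)) (trans (length-reverse B) length-B)

  level : ℕ → ℕ
  level = nth (levels r rs)

  levels≡ : levels r rs ≡ reverse A ++ [ top ]
  levels≡ = cong (_++ [ top ]) (sym reverse-A)

  level-< : ∀ {x} → x < n → level x ≡ a (n ∸ suc x)
  level-< {x} x<n = trans (cong (λ xs → nth xs x) levels≡)
    (trans (nth-reverse-++ A top (subst (x <_) (sym length-A) x<n)) (cong (λ m → a (m ∸ suc x)) length-A))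

  level-n : level n ≡ top
  level-n = trans (cong (λ xs → nth xs n) levels≡) (subst (λ m → nth (reverse A ++ [ top ]) m ≡ top) length-A (nth-reverse-++-last A top))

  lower-height : ∀ {P} → P ≤ n → countBelow (s ∷ ss) (n ∸ P) + firedW P ≡ d
  lower-height {P} P≤n = begin
    countBelow (s ∷ ss) (n ∸ P) + firedW P
      ≡⟨ cong (_+ firedW P) (trans (cong (λ xs → countBelow xs (n ∸ P)) (sym reverse-B)) (countᵇ-reverse _ B)) ⟩
    countᵇ (_<ᵇ n ∸ P) B + firedW P
      ≡⟨ cong (countᵇ (_<ᵇ n ∸ P) B +_) (countᵇ-cong B complement) ⟨
    countᵇ (_<ᵇ n ∸ P) B + countᵇ (not ∘ (_<ᵇ n ∸ P)) B
      ≡⟨ countᵇ+countᵇ-not (_<ᵇ n ∸ P) B ⟩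
    length B
      ≡⟨ length-B ⟩
    d ∎
    where
    open ≡-Reasoning
    complement : ∀ t → not (t <ᵇ n ∸ P) ≡ (n ≤ᵇ t + P)
    complement t with n ≤ᵇ t + P in n≤
    ... | true = cong not (≥⇒<ᵇ≡false (subst (n ∸ P ≤_) (m+n∸n≡m t P) (∸-monoˡ-≤ P (≤ᵇ≡true⇒≤ n≤))))
    ... | false = cong not (<⇒<ᵇ≡true (m+n≤o⇒m≤o∸n (suc t) {P} {n} (≤ᵇ≡false⇒> n≤)))

  cascade-column : ∀ {P} → P < n → n ∸ P + (d ∸ firedW P) ≤ suc (a P)
  cascade-column {P} P<n = +-cancelʳ-≤ (P + firedW P) _ _ (begin
    n ∸ P + (d ∸ firedW P) + (P + firedW P)   ≡⟨ interchange (n ∸ P) (d ∸ firedW P) P (firedW P) ⟩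
    (n ∸ P + P) + (d ∸ firedW P + firedW P)   ≡⟨ cong₂ _+_ (m∸n+n≡m (<⇒≤ P<n)) (m∸n+n≡m (firedW≤d P)) ⟩
    n + d                                     ≤⟨ cascade P<n ⟩
    suc (a P) + (P + firedW P)                ∎)
    where open ≤-Reasoning

  levels-nondecreasing : Nondecreasing (levels r rs)
  levels-nondecreasing = subst Nondecreasing (sym levels≡)
    (reverse-nonincreasing {A} {top} nonincreasing-A
      (λ {k} k< → ≤-pred (subst (a k <_) (trans (+-comm n d) d+n≡1+top) (a<n+d (subst (k <_) length-A k<)))))

  rising : Rising s ss
  rising = subst (λ xs → Nondecreasing (xs ++ [ n ])) reverse-B
    (reverse-nonincreasing {B} {n} nonincreasing-B (λ {j} j< → b≤n (subst (j <_) length-B j<)))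

  above-axis : AboveAxis 1 r rs
  above-axis {i} i≤|rs| with m≤n⇒m<n∨m≡n (subst (suc i ≤_) 1+|rs|≡n (s≤s i≤|rs|))
  ... | inj₁ 2+i≤n = begin
    i + 1                           ≡⟨ +-comm i 1 ⟩
    suc i                           ≤⟨ n≤1+n (suc i) ⟩
    suc (suc i)                     ≡⟨ m∸[m∸n]≡n 2+i≤n ⟨
    n ∸ P                           ≤⟨ m≤m+n (n ∸ P) (d ∸ firedW P) ⟩
    n ∸ P + (d ∸ firedW P)          ≤⟨ cascade-column (∸-monoʳ-< {o = 0} (s≤s z≤n) 2+i≤n) ⟩
    suc (a P)                       ≡⟨ cong suc (level-< 2+i≤n) ⟨
    suc (level (suc i))             ∎
    where
    open ≤-Reasoning
    P : ℕ
    P = n ∸ suc (suc i)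
  ... | inj₂ 1+i≡n = begin
    i + 1                           ≡⟨ +-comm i 1 ⟩
    suc i                           ≡⟨ 1+i≡n ⟩
    n                               ≤⟨ m≤n+m n d ⟩
    d + n                           ≡⟨ d+n≡1+top ⟩
    suc top                         ≡⟨ cong suc level-n ⟨
    suc (level n)                   ≡⟨ cong (suc ∘ level) 1+i≡n ⟨
    suc (level (suc i))             ∎
    where open ≤-Reasoning

  columns : Columns 1 (suc r) r rs
  columns = record { start = refl ; mono = levels-nondecreasing ; above = above-axis }

  lower-below-floor : ∀ {x} → suc x ≤ n → suc x + countBelow (s ∷ ss) (suc x) < floor r rs (suc x)
  lower-below-floor {x} 1+x≤n = s≤s (begin
    suc x + countBelow (s ∷ ss) (suc x)                   ≡⟨ cong₂ _+_ (sym n∸P≡1+x) (cong (countBelow (s ∷ ss)) (sym n∸P≡1+x)) ⟩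
    n ∸ P + countBelow (s ∷ ss) (n ∸ P)                   ≡⟨ cong (n ∸ P +_) (m+n∸n≡m _ (firedW P)) ⟨
    n ∸ P + (countBelow (s ∷ ss) (n ∸ P) + firedW P ∸ firedW P) ≡⟨ cong (λ m → n ∸ P + (m ∸ firedW P)) (lower-height (m∸n≤m n (suc x))) ⟩
    n ∸ P + (d ∸ firedW P)                                ≤⟨ cascade-column (∸-monoʳ-< {o = 0} (s≤s z≤n) 1+x≤n) ⟩
    suc (a P)                                             ≡⟨ cong suc (level-< 1+x≤n) ⟨
    suc (level x)                                         ∎)
    where
    open ≤-Reasoning
    P : ℕ
    P = n ∸ suc x
    n∸P≡1+x : n ∸ P ≡ suc x
    n∸P≡1+x = m∸[m∸n]≡n 1+x≤n

  private
    meets : ∀ p → p ∈ points origin U → p ∈ points origin L → p ≡ origin ⊎ p ≡ (ℤ.+ (n + 1) , ℤ.+ d)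
    meets p p∈U p∈L with ∈-upper⁻ 1+|rs|≡n columns p∈U
    ... | inj₂ p≡end = inj₂ (trans p≡end (cong (λ x → pt x d) (+-comm 1 n)))
    ... | inj₁ (x , y , p≡ , x≤n , floor≤) with ∈-lower⁻ rising p∈L
    ...   | x′ , y′ , p≡′ , _ , y′≤ with pt-injective (trans (sym p≡) p≡′)
    ...     | refl , refl = inj₁ (trans p≡ (at-origin x≤n floor≤ y′≤))
      where
      at-origin : ∀ {x y} → x ≤ n → floor r rs x ≤ x + y → y ≤ countBelow (s ∷ ss) x → pt x y ≡ origin
      at-origin {zero} _ _ y≤ = cong (pt 0) (n≤0⇒n≡0 (subst (_ ≤_) (countᵇ-none (s ∷ ss) (λ t → ≥⇒<ᵇ≡false {t} z≤n)) y≤))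
      at-origin {suc x} {y} x≤n floor≤ y≤ = ⊥-elim (<⇒≱ (lower-below-floor x≤n) (≤-trans floor≤ (+-monoʳ-≤ (suc x) y≤)))

  sawtooth : Sawtooth (n + 1) d (U , L)
  sawtooth = upper-steps r rs , lower-steps s ss ,
    trans (endPt-upper 1+|rs|≡n columns) (cong (λ x → pt x d) (+-comm 1 n)) ,
    trans (endPt-lower rising) (cong₂ pt (+-comm 1 n) 1+|ss|≡d) ,
    meets

  Up Lp : List Point
  Up = points origin U
  Lp = points origin L

  -- One round of the bounce path: from (n ∸ P , d ∸ Q) north-west onto the upper path in
  -- column n ∸ P′, then south onto the lower path at (n ∸ P′ , d ∸ Q′).
  module Round {P Q} (reached : Reached P Q) where

    P′ : ℕ
    P′ = firedV P Q
    Q′ : ℕ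
    Q′ = firedW P′
    p : ℕ
    p = P′ ∸ P
    q : ℕ
    q = Q′ ∸ Q
    x′ : ℕ
    x′ = n ∸ P′
    σ : ℕ
    σ = n ∸ P + (d ∸ Q)

    private
      P≤P′ : P ≤ P′
      P≤P′ = P≤firedV reached
      P′≤n : P′ ≤ n
      P′≤n = firedV≤n P Q
      Q≤Q′ : Q ≤ Q′
      Q≤Q′ = Q≤firedW (reached-cliques reached)
      Q≤d : Q ≤ d
      Q≤d = ≤-trans (Q≤firedW reached) (firedW≤d P)

      p+x′≡ : p + x′ ≡ n ∸ P
      p+x′≡ = ∸-telescope P≤P′ P′≤n

      σ+[P+Q]≡ : σ + (P + Q) ≡ n + d
      σ+[P+Q]≡ = trans (interchange (n ∸ P) (d ∸ Q) P Q) (cong₂ _+_ (m∸n+n≡m (P≤n reached)) (m∸n+n≡m Q≤d))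

      ≤σ : ∀ {t} → n + d ≤ suc (t + (P + Q)) → σ ≤ suc t
      ≤σ {t} h = +-cancelʳ-≤ (P + Q) σ (suc t) (subst (_≤ suc t + (P + Q)) (sym σ+[P+Q]≡) h)

      σ< : ∀ {t} → suc (t + (P + Q)) < n + d → suc t < σ
      σ< {t} h = +-cancelʳ-< (P + Q) (suc t) σ (subst (suc (t + (P + Q)) <_) (sym σ+[P+Q]≡) h)

      lower-at-x′ : countBelow (s ∷ ss) x′ ≡ d ∸ Q′
      lower-at-x′ = trans (sym (m+n∸n≡m _ Q′)) (cong (_∸ Q′) (lower-height P′≤n))

    off-upper : ∀ {X Y} → x′ < X → X ≤ p + x′ → X + Y ≡ p + x′ + (d ∸ Q) → elemP (pt X Y) Up ≡ false
    off-upper {X} {Y} x′<X X≤ X+Y≡ = elemP-∉ not-on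
      where
      X≤n : X ≤ n
      X≤n = ≤-trans X≤ (≤-trans (≤-reflexive p+x′≡) (m∸n≤m n P))
      X+Y≡σ : X + Y ≡ σ
      X+Y≡σ = trans X+Y≡ (cong (_+ (d ∸ Q)) p+x′≡)
      below-floor : ∀ {X} → x′ < X → X ≤ n → X + Y ≡ σ → X + Y < floor r rs X
      below-floor {suc x} x′<X X≤n sum≡ = begin-strict
        suc x + Y                 ≡⟨ sum≡ ⟩
        σ                         ≤⟨ ≤σ (fired-v⁺ P Q (∸-<-flip x′<X X≤n)) ⟩
        suc (a (n ∸ suc x))       <⟨ n<1+n _ ⟩
        2 + a (n ∸ suc x)         ≡⟨ cong (2 +_) (level-< X≤n) ⟨
        floor r rs (suc x)        ∎
        where open ≤-Reasoning
      not-on : pt X Y ∈ Up → ⊥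
      not-on p∈ with ∈-upper⁻ 1+|rs|≡n columns p∈
      ... | inj₂ end = <⇒≱ (s≤s X≤n) (≤-reflexive (sym (proj₁ (pt-injective end))))
      ... | inj₁ (x , y , eq , _ , floor≤) with pt-injective eq
      ...   | refl , refl = <⇒≱ (below-floor x′<X X≤n X+Y≡σ) floor≤

    private
      floor≤σ : ∀ X → X ≡ x′ → floor r rs X ≤ σ
      floor≤σ zero _ = z≤n
      floor≤σ (suc x) 1+x≡x′ = begin
        2 + level x                  ≡⟨ cong (2 +_) (level-< 1+x≤n) ⟩
        2 + a (n ∸ suc x)            ≡⟨ cong (λ m → 2 + a (n ∸ m)) 1+x≡x′ ⟩
        2 + a (n ∸ x′)               ≡⟨ cong (λ m → 2 + a m) (m∸[m∸n]≡n P′≤n) ⟩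
        2 + a P′                     ≤⟨ σ< unfired ⟩
        σ                            ∎
        where
        open ≤-Reasoning
        1+x≤n : suc x ≤ n
        1+x≤n = subst (_≤ n) (sym 1+x≡x′) (m∸n≤m n P′)
        P′<n : P′ < n
        P′<n = m∸n≢0⇒n<m (λ x′≡0 → 1+n≢0 (trans 1+x≡x′ x′≡0))
        unfired : suc (a P′ + (P + Q)) < n + d
        unfired = ≤ᵇ≡false⇒> (trans (fired-v P Q P′<n) (≥⇒<ᵇ≡false (≤-refl {P′})))

      σ≤ceiling : ∀ X → X ≡ x′ → X ≤ n → σ ≤ 2 + level X
      σ≤ceiling X X≡x′ X≤n with m≤n⇒m<n∨m≡n X≤n
      ... | inj₁ X<n = begin
        σ                            ≤⟨ ≤σ (fired-v⁺ P Q (∸-<-flip (subst (_< suc X) X≡x′ (n<1+n X)) X<n)) ⟩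
        suc (a (n ∸ suc X))          ≤⟨ n≤1+n _ ⟩
        2 + a (n ∸ suc X)            ≡⟨ cong (2 +_) (level-< X<n) ⟨
        2 + level X                  ∎
        where open ≤-Reasoning
      ... | inj₂ refl = begin
        σ                            ≤⟨ m≤m+n σ (P + Q) ⟩
        σ + (P + Q)                  ≡⟨ trans σ+[P+Q]≡ (trans (+-comm n d) d+n≡1+top) ⟩
        suc top                      ≤⟨ n≤1+n _ ⟩
        2 + top                      ≡⟨ cong (2 +_) level-n ⟨
        2 + level n                  ∎
        where open ≤-Reasoning

    on-upper : elemP (pt x′ (p + (d ∸ Q))) Up ≡ true
    on-upper = elemP-∈ (∈-upper⁺ 1+|rs|≡n columns (m∸n≤m n P′)
      (subst (floor r rs x′ ≤_) (sym x′+y≡σ) (floor≤σ x′ refl))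
      (subst (_≤ 2 + level x′) (sym x′+y≡σ) (σ≤ceiling x′ refl (m∸n≤m n P′))))
      where
      x′+y≡σ : x′ + (p + (d ∸ Q)) ≡ σ
      x′+y≡σ = trans (sym (+-assoc x′ p (d ∸ Q))) (cong (_+ (d ∸ Q)) (trans (+-comm x′ p) p+x′≡))

    off-lower : ∀ {Y} → d ∸ Q′ < Y → Y ≤ (p + q) + (d ∸ Q′) → elemP (pt x′ Y) Lp ≡ false
    off-lower {Y} above _ = elemP-∉ not-on
      where
      not-on : pt x′ Y ∈ Lp → ⊥
      not-on p∈ with ∈-lower⁻ rising p∈
      ... | x , y , eq , _ , y≤ with pt-injective eq
      ...   | refl , refl = <⇒≱ above (subst (Y ≤_) lower-at-x′ y≤)

    on-lower : elemP (pt x′ (d ∸ Q′)) Lp ≡ true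
    on-lower = elemP-∈ (subst (λ y → pt x′ y ∈ Lp) lower-at-x′ (∈-lower⁺ rising (≤-trans (m∸n≤m n P′) (n≤1+n n))))

    drop : p + (d ∸ Q) ≡ (p + q) + (d ∸ Q′)
    drop = trans (cong (p +_) (sym (∸-telescope Q≤Q′ (firedW≤d P′)))) (sym (+-assoc p q (d ∸ Q′)))

    landed : isOrigin (pt x′ (d ∸ Q′)) ≡ (n ≤ᵇ P′)
    landed with m≤n⇒m<n∨m≡n P′≤n
    ... | inj₁ P′<n = trans (dec-false (≡-dec ℤ._≟_ ℤ._≟_ (pt x′ (d ∸ Q′)) origin)
                        (λ eq → <⇒≢ (m<n⇒0<n∸m P′<n) (sym (proj₁ (pt-injective eq)))))
                      (sym (>⇒≤ᵇ≡false P′<n))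
    ... | inj₂ P′≡n = trans (dec-true (≡-dec ℤ._≟_ ℤ._≟_ (pt x′ (d ∸ Q′)) origin)
                        (cong₂ pt (trans (cong (n ∸_) P′≡n) (n∸n≡0 n)) (trans (cong (λ m → d ∸ firedW m) P′≡n) (trans (cong (d ∸_) firedW-n) (n∸n≡0 d)))))
                      (sym (≤⇒≤ᵇ≡true (≤-reflexive (sym P′≡n))))

    bounce-round : ∀ F → bounceLoop (p + suc ((p + q) + suc F)) Up Lp goNW (pt (n ∸ P) (d ∸ Q)) 0 0 ≡
      reportRound (n ≤ᵇ P′) (p , p + q) (bounceLoop F Up Lp goNW (pt x′ (d ∸ Q′)) 0 0)
    bounce-round F = begin
      bounceLoop (p + suc G) Up Lp goNW (pt (n ∸ P) (d ∸ Q)) 0 0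
        ≡⟨ cong (λ x → bounceLoop (p + suc G) Up Lp goNW (pt x (d ∸ Q)) 0 0) p+x′≡ ⟨
      bounceLoop (p + suc G) Up Lp goNW (pt (p + x′) (d ∸ Q)) 0 0
        ≡⟨ nw-run Up Lp p off-upper on-upper ⟩
      bounceLoop G Up Lp goS (pt x′ (p + (d ∸ Q))) p 0
        ≡⟨ cong (λ y → bounceLoop G Up Lp goS (pt x′ y) p 0) drop ⟩
      bounceLoop G Up Lp goS (pt x′ ((p + q) + (d ∸ Q′))) p 0
        ≡⟨ s-run Up Lp (p + q) off-lower on-lower ⟩
      reportRound (isOrigin (pt x′ (d ∸ Q′))) (p , p + q) (bounceLoop F Up Lp goNW (pt x′ (d ∸ Q′)) 0 0)
        ≡⟨ cong (λ b → reportRound b (p , p + q) (bounceLoop F Up Lp goNW (pt x′ (d ∸ Q′)) 0 0)) landed ⟩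
      reportRound (n ≤ᵇ P′) (p , p + q) (bounceLoop F Up Lp goNW (pt x′ (d ∸ Q′)) 0 0) ∎
      where
      open ≡-Reasoning
      G : ℕ
      G = (p + q) + suc F

  BounceFrom : ℕ → ℕ → List (ℕ × ℕ) → Set
  BounceFrom P Q T = ∃[ fuel ] bounceLoop fuel Up Lp goNW (pt (n ∸ P) (d ∸ Q)) 0 0 ≡ just (map (λ pq → (proj₁ pq , proj₁ pq + proj₂ pq)) T)

  ctiBounce : CtiBounce n d (U , L) (rounds (suc n) 0 0)
  ctiBounce = Iterate.yields BounceFrom last more
    where
    last : ∀ {P Q} → Reached P Q → n ≤ firedV P Q → BounceFrom P Q (round P Q ∷ [])
    last r done = p + suc ((p + q) + suc 0) , trans (bounce-round 0)
      (cong (λ b → reportRound b (p , p + q) (bounceLoop 0 Up Lp goNW (pt x′ (d ∸ Q′)) 0 0))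
            (≤⇒≤ᵇ≡true done))
      where open Round r
    more : ∀ {P Q T} → Reached P Q → firedV P Q < n → BounceFrom (firedV P Q) (firedW (firedV P Q)) T → BounceFrom P Q (round P Q ∷ T)
    more r not-done (fuel , ends) = p + suc ((p + q) + suc fuel) , trans (bounce-round fuel)
      (trans (cong (λ b → reportRound b (p , p + q) (bounceLoop fuel Up Lp goNW (pt x′ (d ∸ Q′)) 0 0))
                   (>⇒≤ᵇ≡false not-done))
             (cong (Maybe.map ((p , p + q) ∷_)) ends))
      where open Round r

  ℓ : ℕ → ℕ
  ℓ = countBelow (s ∷ ss)

  area≡∑ : area (U , L) ≡ ∑ (suc n) (λ x → suc (level x) ∸ x ∸ ℓ x)
  area≡∑ = begin
    area (U , L)
      ≡⟨ cong₂ (λ hs ℓs → sum (zipWith gap hs ℓs)) (stepHeights-upper 1+|rs|≡n columns) (stepHeights-lower rising) ⟩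
    sum (zipWith gap (applyUpTo (λ x → ℤ.+ suc (suc (level x) ∸ x)) (suc n)) (applyUpTo (λ x → ℤ.+ ℓ x) (suc n)))
      ≡⟨ cong sum (zipWith-applyUpTo gap (λ x → ℤ.+ suc (suc (level x) ∸ x)) (λ x → ℤ.+ ℓ x) (suc n)) ⟩
    ∑ (suc n) (λ x → gap (ℤ.+ suc (suc (level x) ∸ x)) (ℤ.+ ℓ x))
      ≡⟨ ∑-cong (suc n) (λ {x} _ → column-area (suc (level x) ∸ x) (ℓ x)) ⟩
    ∑ (suc n) (λ x → suc (level x) ∸ x ∸ ℓ x) ∎
    where
    open ≡-Reasoning
    gap : ℤ.ℤ → ℤ.ℤ → ℕ
    gap h k = ℤ.∣ (h ℤ.- ℤ.1ℤ ℤ.- k) ℤ.⊔ ℤ.+ 0 ∣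

  lower≤upper : ∀ {x} → x ≤ n → x + ℓ x ≤ suc (level x)
  lower≤upper {x} x≤n with m≤n⇒m<n∨m≡n x≤n
  ... | inj₁ x<n = begin
    x + ℓ x                   ≤⟨ +-monoʳ-≤ x (countᵇ-mono (s ∷ ss) (λ t t<x → <⇒<ᵇ≡true {t} {suc x} (m≤n⇒m≤1+n (<ᵇ≡true⇒< {t} {x} t<x)))) ⟩
    x + ℓ (suc x)             ≤⟨ n≤1+n _ ⟩
    suc x + ℓ (suc x)         ≤⟨ ≤-pred (lower-below-floor x<n) ⟩
    suc (level x)             ∎
    where open ≤-Reasoning
  ... | inj₂ refl = begin
    n + ℓ n                   ≤⟨ +-monoʳ-≤ n (subst (ℓ n ≤_) 1+|ss|≡d (countᵇ≤length _ (s ∷ ss))) ⟩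
    n + d                     ≡⟨ trans (+-comm n d) d+n≡1+top ⟩
    suc top                   ≡⟨ cong suc level-n ⟨
    suc (level n)             ∎
    where open ≤-Reasoning

  ∑-level : ∑ (suc n) level ≡ sum A + top
  ∑-level = begin
    ∑ (suc n) level                           ≡⟨ cong (λ m → ∑ m level) (sym length-levels) ⟩
    ∑ (length (levels r rs)) level            ≡⟨ ∑-nth (levels r rs) ⟩
    sum (levels r rs)                         ≡⟨ cong sum levels≡ ⟩
    sum (reverse A ++ [ top ])                ≡⟨ sum-++ (reverse A) [ top ] ⟩
    sum (reverse A) + (top + 0)               ≡⟨ cong₂ _+_ (sum-↭ (↭-reverse A)) (+-identityʳ top) ⟩
    sum A + top                               ∎
    where
    open ≡-Reasoning
    length-levels : length (levels r rs) ≡ suc n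
    length-levels = trans (cong length levels≡) (trans (length-++ (reverse A)) (trans (+-comm _ 1) (cong suc (trans (length-reverse A) length-A))))

  ∑-ℓ : ∑ (suc n) ℓ + sum B ≡ n * d
  ∑-ℓ = begin
    ∑ (suc n) ℓ + sum B                       ≡⟨ cong (∑ (suc n) ℓ +_) (trans (sym (sum-↭ (↭-reverse B))) (cong sum reverse-B)) ⟩
    ∑ (suc n) ℓ + sum (s ∷ ss)                ≡⟨ ∑-countBelow n (s ∷ ss) (subst (All (_≤ n)) reverse-B (All-resp-↭ (↭-sym (↭-reverse B)) B≤n)) ⟩
    n * suc (length ss)                       ≡⟨ cong (n *_) 1+|ss|≡d ⟩
    n * d                                     ∎
    where
    open ≡-Reasoning
    B≤n : All (_≤ n) B
    B≤n = map⁺ (tabulate⁺ (λ j → ≤-pred (subst (c (w j) <_) (+-comm n 1) (stable (w j)))))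

  height≡ : height c ≡ sum A + sum B
  height≡ = trans (cong sum (map-++ c (map v (allFin n)) (map w (allFin d))))
    (trans (sum-++ (map c (map v (allFin n))) (map c (map w (allFin d))))
      (cong₂ _+_ (cong sum (sym (map-∘ (allFin n)))) (cong sum (sym (map-∘ (allFin d))))))

  column-sums : area (U , L) + ∑ (suc n) (λ x → x + ℓ x) ≡ n + (sum A + (d + n))
  column-sums = begin
    area (U , L) + ∑ (suc n) (λ x → x + ℓ x)
      ≡⟨ cong (_+ ∑ (suc n) (λ x → x + ℓ x)) area≡∑ ⟩
    ∑ (suc n) (λ x → suc (level x) ∸ x ∸ ℓ x) + ∑ (suc n) (λ x → x + ℓ x)
      ≡⟨ ∑-+ (suc n) (λ x → suc (level x) ∸ x ∸ ℓ x) (λ x → x + ℓ x) ⟨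
    ∑ (suc n) (λ x → suc (level x) ∸ x ∸ ℓ x + (x + ℓ x))
      ≡⟨ ∑-cong (suc n) (λ {x} x<1+n → trans (cong (_+ (x + ℓ x)) (∸-+-assoc (suc (level x)) x (ℓ x))) (m∸n+n≡m (lower≤upper (≤-pred x<1+n)))) ⟩
    ∑ (suc n) (λ x → suc (level x))
      ≡⟨ ∑-+ (suc n) (λ _ → 1) level ⟩
    ∑ (suc n) (λ _ → 1) + ∑ (suc n) level
      ≡⟨ cong₂ _+_ (trans (∑-const (suc n) 1) (*-identityʳ (suc n))) ∑-level ⟩
    suc n + (sum A + top)
      ≡⟨ trans (cong (n +_) (+-suc (sum A) top)) (+-suc n (sum A + top)) ⟨
    n + (sum A + suc top)
      ≡⟨ cong (λ m → n + (sum A + m)) (trans (sym d+n≡1+top) (+-comm d n)) ⟩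
    n + (sum A + (n + d))
      ≡⟨ cong (λ m → n + (sum A + m)) (+-comm n d) ⟩
    n + (sum A + (d + n)) ∎
    where open ≡-Reasoning

  area-formula : height c + (n + d) + d C 2 ≡ area (U , L) + (n + d) C 2
  area-formula = begin
    height c + (n + d) + d C 2
      ≡⟨ cong (λ h → h + (n + d) + d C 2) height≡ ⟩
    sum A + sum B + (n + d) + d C 2
      ≡⟨ rearrange (area (U , L)) (sum A) (sum B) (∑ (suc n) ℓ) (n C 2) (d C 2) n d column-sums′ ⟩
    area (U , L) + (n C 2 + d C 2 + (∑ (suc n) ℓ + sum B))
      ≡⟨ cong (λ m → area (U , L) + (n C 2 + d C 2 + m)) ∑-ℓ ⟩
    area (U , L) + (n C 2 + d C 2 + n * d)
      ≡⟨ cong (area (U , L) +_) ([m+n]C2 n d) ⟨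
    area (U , L) + (n + d) C 2 ∎
    where
    open ≡-Reasoning
    column-sums′ : area (U , L) + (n C 2 + n + ∑ (suc n) ℓ) ≡ n + (sum A + (d + n))
    column-sums′ = trans (cong (area (U , L) +_) (sym (trans (∑-+ (suc n) id ℓ) (cong (_+ ∑ (suc n) ℓ) (trans (∑-id (suc n)) ([1+m]C2 n)))))) column-sums
    rearrange : ∀ area sA sB Σℓ Cn Cd n d → area + (Cn + n + Σℓ) ≡ n + (sA + (d + n)) →
      sA + sB + (n + d) + Cd ≡ area + (Cn + Cd + (Σℓ + sB))
    rearrange area sA sB Σℓ Cn Cd n d columns = +-cancelʳ-≡ n _ _ (begin
      sA + sB + (n + d) + Cd + n                       ≡⟨ lemma₁ sA sB n d Cd ⟩
      n + (sA + (d + n)) + Cd + sB                     ≡⟨ cong (λ m → m + Cd + sB) columns ⟨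
      area + (Cn + n + Σℓ) + Cd + sB                   ≡⟨ lemma₂ area Cn n Σℓ Cd sB ⟩
      area + (Cn + Cd + (Σℓ + sB)) + n                 ∎)
      where
      lemma₁ : ∀ sA sB n d Cd → sA + sB + (n + d) + Cd + n ≡ n + (sA + (d + n)) + Cd + sB
      lemma₁ = solve-∀
      lemma₂ : ∀ area Cn n Σℓ Cd sB → area + (Cn + n + Σℓ) + Cd + sB ≡ area + (Cn + Cd + (Σℓ + sB)) + n
      lemma₂ = solve-∀

nonempty : ∀ {A : Set} (xs : List A) → 1 ≤ length xs → ∃₂ λ y ys → xs ≡ y ∷ ys
nonempty (y ∷ ys) _ = y , ys , refl

theorem4p11 : (n d : ℕ) → 1 ≤ n → 1 ≤ d → (c : Cfg n d) → SortedRec c →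
    Sawtooth (n + 1) d (f c) ×
    (height c + (n + d) + d C 2 ≡ area (f c) + (n + d) C 2) ×
    Σ (List (ℕ × ℕ)) (λ T → ToppleCTI c T × CtiBounce n d (f c) T)
theorem4p11 n d 1≤n 1≤d c ((stable , recurrent) , sorted)
  with nonempty (reverse A) (subst (1 ≤_) (sym (trans (length-reverse A) length-A)) 1≤n)
     | nonempty (reverse B) (subst (1 ≤_) (sym (trans (length-reverse B) length-B)) 1≤d)
  where open Split c
... | r , rs , reverse-A | s , ss , reverse-B
  rewrite reverse-A | reverse-B =
  sawtooth , area-formula , rounds (suc n) 0 0 , toppleCTI , ctiBounce
  where
  open Split c
  cascade : Cascade
  cascade = SortedStable.recurrent⇒cascade stable sorted (stable , recurrent)
  open Dynamics c stable sorted cascade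
  open ImagePaths c stable sorted cascade 1≤d reverse-A reverse-B
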